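{- Let $\Sigma$ be a signed graph and let $v$ be a positive or negative dominating vertex of $\Sigma$. If $\Sigma\setminus v$ is balanced, then \[ \mathsf E(\Sigma,x,y)-\mathsf O(\Sigma,x,y)=\mathsf E(\Sigma\setminus v,x-1,y+1)-\mathsf E(\Sigma\setminus v,x-1,y). \]
   Context: A signed graph $\Sigma=(\Gamma,\sigma)$ is a finite simple graph $\Gamma$ with a signature $\sigma:E(\Gamma)\to\{\pm1\}$; it is balanced if every cycle has an even number of negative edges. A vertex $v$ is a positive (resp. negative) dominating vertex if it is joined by a positive (resp. negative) edge to every other vertex; the single vertex of $K_1$ counts as both. $\Sigma\setminus v$ is obtained by deleting $v$ and its incident edges (the vertexless graph $K_0$ has $\mathsf E(K_0,x,y)=\mathsf O(K_0,x,y)=1$). For a finite $C\subseteq\mathbb Z$, a proper $C$-colouring of $\Sigma$ is a map $\kappa:V(\Gamma)\to C$ with $\kappa(v)\ne\sigma(\{v,w\})\kappa(w)$ for every edge $\{v,w\}$. For integers $\lambda\ge\mu\ge0$, a finite $C\subseteq\mathbb Z$ is a $(\lambda,\mu)$-colour set if there are disjoint sets $P,U$ of nonzero integers with $-P=P$, $|U|=\mu$, $(-U)\cap U=\varnothing$, and either $\lambda-\mu$ even, $|P|=\lambda-\mu$, $C=P\cup U$, or $\lambda-\mu$ odd, $|P|=\lambda-\mu-1$, $C=P\cup U\cup\{0\}$. $f(\Sigma,\lambda,\mu)$ is the number of proper $C$-colourings for any $(\lambda,\mu)$-colour set $C$ (independent of $C$). $\mathsf E(\Sigma,x,y),\mathsf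 O(\Sigma,x,y)\in\mathbb Z[x,y]$ are the unique polynomials with $f(\Sigma,\lambda,\mu)=\mathsf E(\Sigma,\lambda,\mu)$ for all integers $\lambda\ge\mu\ge0$ with $\lambda-\mu$ even and $f(\Sigma,\lambda,\mu)=\mathsf O(\Sigma,\lambda,\mu)$ whenever $\lambda-\mu$ is odd. -}

module Defs where

open import Data.Nat using (ℕ; zero; suc; _∸_; _≤_; _%_)
open import Data.Integer as ℤ using (ℤ; 0ℤ)
open import Data.Fin using (Fin; zero; suc; inject₁; fromℕ; punchIn)
open import Data.Bool using (Bool; true; false; not; _∧_)
open import Data.Maybe using (Maybe; just; nothing)
open import Data.Sign using (Sign)
open import Data.List using (List; []; _∷_; length; filter; map; concatMap; allFin)
open import Data.Nat.ListAction using (sum)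
open import Data.Bool.ListAction using (all)
open import Data.List.Membership.Propositional using (_∈_; _∉_)
open import Data.List.Relation.Unary.Unique.Propositional using (Unique)
open import Data.Vec using (Vec; lookup) renaming ([] to []ᵥ; _∷_ to _∷ᵥ_)
open import Data.Product using (Σ; ∃; ∃-syntax; _×_)
open import Data.Sum using (_⊎_)
open import Function.Bundles using (_⇔_)
open import Function.Definitions using (Injective)
open import Relation.Binary.PropositionalEquality using (_≡_; _≢_)
open import Relation.Nullary.Decidable using (⌊_⌋)

-- Signed graphs on vertex set Fin n.
-- edge i j = nothing : no edge; edge i j = just s : an edge of sign s.
-- Simple graph: symmetric, no loops.

record SignedGraph (n : ℕ) : Set where
  field
    edge   : Fin n → Fin n → Maybe Sign
    symm   : ∀ i j → edge i j ≡ edge j i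
    noLoop : ∀ i → edge i i ≡ nothing
open SignedGraph public

-- Σ \ v : delete vertex v (vertices of the result are re-indexed by punchIn v)
deleteVertex : ∀ {n} → SignedGraph (suc n) → Fin (suc n) → SignedGraph n
deleteVertex G v = record
  { edge   = λ i j → edge G (punchIn v i) (punchIn v j)
  ; symm   = λ i j → symm G (punchIn v i) (punchIn v j)
  ; noLoop = λ i → noLoop G (punchIn v i)
  }

DominatingOfSign : ∀ {n} → SignedGraph n → Fin n → Sign → Set
DominatingOfSign G v s = ∀ w → w ≢ v → edge G v w ≡ just s

PositiveDominating NegativeDominating : ∀ {n} → SignedGraph n → Fin n → Set
PositiveDominating G v = DominatingOfSign G v Sign.+
NegativeDominating G v = DominatingOfSign G v Sign.-

-- Cycles and balance.
-- A cycle of length suc L (L ≥ 2) is an injective map c : Fin (suc L) → Fin n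
-- with edges c(i) — c(i+1) for i < L and the closing edge c(L) — c(0).

isNeg : Maybe Sign → ℕ
isNeg (just Sign.-) = 1
isNeg _             = 0

IsEdge : Maybe Sign → Set
IsEdge e = e ≢ nothing

IsCycle : ∀ {n L} → SignedGraph n → (Fin (suc L) → Fin n) → Set
IsCycle {L = L} G c =
  Injective _≡_ _≡_ c ×
  ((∀ (i : Fin L) → IsEdge (edge G (c (inject₁ i)) (c (suc i)))) ×
   IsEdge (edge G (c (fromℕ L)) (c zero)))

negEdges : ∀ {n L} → SignedGraph n → (Fin (suc L) → Fin n) → ℕ
negEdges {L = L} G c =
  sum (map (λ i → isNeg (edge G (c (inject₁ i)) (c (suc i)))) (allFin L))
  Data.Nat.+ isNeg (edge G (c (fromℕ L)) (c zero))

Balanced : ∀ {n} → SignedGraph n → Set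
Balanced {n} G = ∀ (m : ℕ) (c : Fin (suc (suc (suc m))) → Fin n) →
  IsCycle G c → negEdges G c % 2 ≡ 0

applySign : Sign → ℤ → ℤ
applySign Sign.+ a = a
applySign Sign.- a = ℤ.- a

edgeOK : Maybe Sign → ℤ → ℤ → Bool
edgeOK nothing  a b = true
edgeOK (just s) a b = not ⌊ a ℤ.≟ applySign s b ⌋

isProper : ∀ {n} → SignedGraph n → Vec ℤ n → Bool
isProper {n} G κ =
  all (λ i → all (λ j → edgeOK (edge G i j) (lookup κ i) (lookup κ j)) (allFin n)) (allFin n)

allMaps : List ℤ → (n : ℕ) → List (Vec ℤ n)
allMaps C zero    = []ᵥ ∷ []
allMaps C (suc n) = concatMap (λ c → map (c ∷ᵥ_) (allMaps C n)) C

-- number of proper C-colourings (C a duplicate-free list representing a finite set)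
numProperColourings : ∀ {n} → SignedGraph n → List ℤ → ℕ
numProperColourings {n} G C = length (filter (λ κ → isProper G κ Data.Bool.≟ true) (allMaps C n))

IsColourSet : ℕ → ℕ → List ℤ → Set
IsColourSet l m C =
  Unique C × ∃[ P ] ∃[ U ]
    (Unique P × Unique U ×
     (∀ x → x ∈ P → x ≢ 0ℤ) × (∀ x → x ∈ U → x ≢ 0ℤ) ×
     (∀ x → x ∈ P → x ∈ U → Data.Empty.⊥) ×
     (∀ x → x ∈ P → ℤ.- x ∈ P) ×
     (∀ x → x ∈ U → ℤ.- x ∉ U) ×
     length U ≡ m ×
     ((((l ∸ m) % 2 ≡ 0) × length P ≡ l ∸ m × (∀ x → x ∈ C ⇔ (x ∈ P ⊎ x ∈ U)))
      ⊎
      (((l ∸ m) % 2 ≡ 1) × length P ≡ (l ∸ m) ∸ 1 × (∀ x → x ∈ C ⇔ (x ∈ P ⊎ x ∈ U ⊎ x ≡ 0ℤ)))))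
  where import Data.Empty

-- Polynomials in ℤ[x,y]: p = [p₀, p₁, …] with pᵢ ∈ ℤ[y] a coefficient list
-- [a_{i0}, a_{i1}, …], representing Σᵢ Σⱼ a_{ij} xⁱ yʲ.

Poly1 : Set
Poly1 = List ℤ

Poly2 : Set
Poly2 = List Poly1

eval1 : Poly1 → ℤ → ℤ
eval1 []       y = 0ℤ
eval1 (a ∷ as) y = a ℤ.+ y ℤ.* eval1 as y

eval2 : Poly2 → ℤ → ℤ → ℤ
eval2 []       x y = 0ℤ
eval2 (p ∷ ps) x y = eval1 p y ℤ.+ x ℤ.* eval2 ps x y

-- p is the polynomial E(Σ,x,y): agrees with f(Σ,λ,μ) (the number of proper
-- C-colourings for any (λ,μ)-colour set C) whenever λ ≥ μ ≥ 0, λ-μ even.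
IsEPoly : ∀ {n} → SignedGraph n → Poly2 → Set
IsEPoly G p = ∀ (l m : ℕ) → m ≤ l → (l ∸ m) % 2 ≡ 0 →
  ∀ (C : List ℤ) → IsColourSet l m C →
  eval2 p (ℤ.+ l) (ℤ.+ m) ≡ ℤ.+ numProperColourings G C

-- p is the polynomial O(Σ,x,y): same, for λ-μ odd.
IsOPoly : ∀ {n} → SignedGraph n → Poly2 → Set
IsOPoly G p = ∀ (l m : ℕ) → m ≤ l → (l ∸ m) % 2 ≡ 1 →
  ∀ (C : List ℤ) → IsColourSet l m C →
  eval2 p (ℤ.+ l) (ℤ.+ m) ≡ ℤ.+ numProperColourings G C

{-# OPTIONS --safe #-}
-- Let σ be the sign of the dominating vertex v. A proper colouring of Σ with colour set C is a
-- colour c for v together with a proper colouring of Σ \ v by C ∖ {σc}, and C ∖ {σc} is again a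
-- colour set: with parameters (λ - 1, μ) if c = 0, (λ - 1, μ + 1) if c is paired, and, if c is
-- unpaired, (λ - 1, μ - 1) for σ = + and (λ, μ) for σ = -. Since Σ \ v is balanced, a switching
-- turns its colourings into list colourings of the underlying graph; their number depends only
-- on μ and λ - μ and is a polynomial in λ - μ, so it is given by E(Σ \ v) for both parities.
-- Summing over c gives E(Σ) = (x - y) A + y V and O(Σ) = B + (x - y - 1) A + y V, where
-- A = E(Σ \ v, x - 1, y + 1), B = E(Σ \ v, x - 1, y), and V is E(Σ \ v) at (x - 1, y - 1) or at
-- (x, y) according to σ. Both sides are polynomials agreeing at all points (μ + r + 2k, μ),
-- hence everywhere, and subtracting the two identities gives the theorem.
module Submission where

module FiniteDifferences where

  open import Data.Nat as ℕ using (ℕ; zero; suc; _≤_; _≤′_; ≤′-refl; ≤′-step; _⊔_)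
  import Data.Nat.Properties as ℕ
  open import Data.Integer using (ℤ; +_; -[1+_]; 0ℤ; -1ℤ; _+_; _-_; _*_; -_)
  open import Data.Integer.Properties using (i-j≡0⇒i≡j; i≡j⇒i-j≡0; +-inverseʳ; +-identityʳ; +-assoc; *-zeroʳ; pos-+; -1*i≡-i)
  open import Data.Integer.Tactic.RingSolver using (solve-∀)
  open import Data.List using ([]; _∷_; length)
  open import Data.Product using (∃; _,_)
  open import Data.Sum using (_⊎_; inj₁; inj₂)
  open import Function using (_∘_)
  open import Relation.Binary.PropositionalEquality
  open ≡-Reasoning
  open import Defs using (eval1; eval2)

  Δ : (ℕ → ℤ) → ℕ → ℤ
  Δ f t = f (suc t) - f t

  data DegreeBelow : ℕ → (ℕ → ℤ) → Set where
    vanishing : ∀ {f} → (∀ t → f t ≡ 0ℤ) → DegreeBelow 0 f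
    Δ-below   : ∀ {N f} → DegreeBelow N (Δ f) → DegreeBelow (suc N) f

  degreeBelow-cong : ∀ {N f g} → f ≗ g → DegreeBelow N f → DegreeBelow N g
  degreeBelow-cong f≗g (vanishing f≡0) = vanishing (λ t → trans (sym (f≗g t)) (f≡0 t))
  degreeBelow-cong f≗g (Δ-below df)    = Δ-below (degreeBelow-cong (λ t → cong₂ _-_ (f≗g (suc t)) (f≗g t)) df)

  degreeBelow-suc : ∀ {N f} → DegreeBelow N f → DegreeBelow (suc N) f
  degreeBelow-suc (vanishing f≡0) = Δ-below (vanishing (λ t → cong₂ _-_ (f≡0 (suc t)) (f≡0 t)))
  degreeBelow-suc (Δ-below df)    = Δ-below (degreeBelow-suc df)

  degreeBelow-mono : ∀ {N M f} → N ≤ M → DegreeBelow N f → DegreeBelow M f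
  degreeBelow-mono N≤M = go (ℕ.≤⇒≤′ N≤M)
    where
    go : ∀ {N M f} → N ≤′ M → DegreeBelow N f → DegreeBelow M f
    go ≤′-refl      df = df
    go (≤′-step le) df = degreeBelow-suc (go le df)

  degreeBelow-zero : ∀ N → DegreeBelow N (λ _ → 0ℤ)
  degreeBelow-zero zero    = vanishing (λ _ → refl)
  degreeBelow-zero (suc N) = Δ-below (degreeBelow-zero N)

  degreeBelow-const : ∀ c → DegreeBelow 1 (λ _ → c)
  degreeBelow-const c = Δ-below (vanishing (λ _ → +-inverseʳ c))

  degreeBelow-+ : ∀ {N f g} → DegreeBelow N f → DegreeBelow N g → DegreeBelow N (λ t → f t + g t)
  degreeBelow-+ (vanishing f≡0) (vanishing g≡0) = vanishing (λ t → cong₂ _+_ (f≡0 t) (g≡0 t))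
  degreeBelow-+ {f = f} {g} (Δ-below df) (Δ-below dg) =
    Δ-below (degreeBelow-cong (λ t → Δ-+ (f (suc t)) (f t) (g (suc t)) (g t)) (degreeBelow-+ df dg))
    where
    Δ-+ : ∀ a b c d → (a - b) + (c - d) ≡ (a + c) - (b + d)
    Δ-+ = solve-∀

  degreeBelow-*ˡ : ∀ {N} c {f} → DegreeBelow N f → DegreeBelow N (λ t → c * f t)
  degreeBelow-*ˡ c (vanishing f≡0) = vanishing (λ t → trans (cong (c *_) (f≡0 t)) (*-zeroʳ c))
  degreeBelow-*ˡ c {f} (Δ-below df) =
    Δ-below (degreeBelow-cong (λ t → Δ-* c (f (suc t)) (f t)) (degreeBelow-*ˡ c df))
    where
    Δ-* : ∀ c a b → c * (a - b) ≡ c * a - c * b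
    Δ-* = solve-∀

  degreeBelow-∘suc : ∀ {N f} → DegreeBelow N f → DegreeBelow N (f ∘ suc)
  degreeBelow-∘suc (vanishing f≡0) = vanishing (f≡0 ∘ suc)
  degreeBelow-∘suc (Δ-below df)    = Δ-below (degreeBelow-∘suc df)

  degreeBelow-*id : ∀ {N f} → DegreeBelow N f → DegreeBelow (suc N) (λ t → + t * f t)
  degreeBelow-*id (vanishing f≡0) =
    degreeBelow-suc (vanishing (λ t → trans (cong (+ t *_) (f≡0 t)) (*-zeroʳ (+ t))))
  degreeBelow-*id {f = f} df@(Δ-below dΔf) =
    Δ-below (degreeBelow-cong (λ t → Δ-*id t (f (suc t)) (f t))
      (degreeBelow-+ (degreeBelow-∘suc df) (degreeBelow-*id dΔf)))
    where
    Δ-*id : ∀ t a b → a + + t * (a - b) ≡ + suc t * a - + t * b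
    Δ-*id t a b = trans (ring a b (+ t)) (cong (λ s → s * a - + t * b) (sym (pos-+ 1 t)))
      where
      ring : ∀ a b s → a + s * (a - b) ≡ (+ 1 + s) * a - s * b
      ring = solve-∀

  x≡-x⇒x≡0 : ∀ {x} → x ≡ - x → x ≡ 0ℤ
  x≡-x⇒x≡0 {+ zero}    _ = refl
  x≡-x⇒x≡0 {+ suc n}   ()
  x≡-x⇒x≡0 { -[1+ n ]} ()

  Δ≡0⇒constant : ∀ f → (∀ t → Δ f t ≡ 0ℤ) → ∀ t → f t ≡ f 0
  Δ≡0⇒constant f Δf≡0 zero    = refl
  Δ≡0⇒constant f Δf≡0 (suc t) = trans (i-j≡0⇒i≡j _ _ (Δf≡0 t)) (Δ≡0⇒constant f Δf≡0 t)

  antiperiodic⇒zero : ∀ {N f} → (∀ t → f (suc t) ≡ - f t) → DegreeBelow N f → ∀ t → f t ≡ 0ℤ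
  antiperiodic⇒zero anti (vanishing f≡0) = f≡0
  antiperiodic⇒zero {f = f} anti (Δ-below df) t =
    x≡-x⇒x≡0 (trans (sym (i-j≡0⇒i≡j _ _ (antiperiodic⇒zero Δf-anti df t))) (anti t))
    where
    Δf-anti : ∀ t → Δ f (suc t) ≡ - Δ f t
    Δf-anti t = begin
      f (suc (suc t)) - f (suc t) ≡⟨ cong (_- f (suc t)) (anti (suc t)) ⟩
      - f (suc t) - f (suc t)     ≡⟨ cong (λ b → - f (suc t) - b) (anti t) ⟩
      - f (suc t) - - f t         ≡⟨ ring (f (suc t)) (f t) ⟩
      - (f (suc t) - f t)         ∎
      where
      ring : ∀ a b → - a - - b ≡ - (a - b)
      ring = solve-∀

  vanishing-on-evens⇒zero : ∀ {N f} → DegreeBelow N f → (∀ k → f (k ℕ.+ k) ≡ 0ℤ) → ∀ t → f t ≡ 0ℤ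
  vanishing-on-evens⇒zero (vanishing f≡0) _ = f≡0
  vanishing-on-evens⇒zero {f = f} (Δ-below dΔf) f-even t =
    trans (Δ≡0⇒constant f Δf≡0 t) (f-even 0)
    where
    ring : ∀ a b c → (a - b) + (b - c) ≡ a - c
    ring = solve-∀
    difference₂ : ℕ → ℤ
    difference₂ t = f (2 ℕ.+ t) - f t
    difference₂-even : ∀ k → difference₂ (k ℕ.+ k) ≡ 0ℤ
    difference₂-even k rewrite sym (ℕ.+-suc k k) | f-even (suc k) | f-even k = refl
    periodic : ∀ t → f (2 ℕ.+ t) ≡ f t
    periodic t = i-j≡0⇒i≡j _ _ (vanishing-on-evens⇒zero
      (degreeBelow-cong (λ t → ring (f (2 ℕ.+ t)) (f (suc t)) (f t)) (degreeBelow-+ (degreeBelow-∘suc dΔf) dΔf))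
      difference₂-even t)
    Δf-anti : ∀ t → Δ f (suc t) ≡ - Δ f t
    Δf-anti t = begin
      f (2 ℕ.+ t) - f (suc t) ≡⟨ cong (_- f (suc t)) (periodic t) ⟩
      f t - f (suc t)         ≡⟨ ring′ (f (suc t)) (f t) ⟩
      - (f (suc t) - f t)     ∎
      where
      ring′ : ∀ a b → b - a ≡ - (a - b)
      ring′ = solve-∀
    Δf≡0 : ∀ t → Δ f t ≡ 0ℤ
    Δf≡0 = antiperiodic⇒zero Δf-anti dΔf

  agreeing-on-evens⇒equal : ∀ {N M f g} → DegreeBelow N f → DegreeBelow M g →
    (∀ k → f (k ℕ.+ k) ≡ g (k ℕ.+ k)) → ∀ t → f t ≡ g t
  agreeing-on-evens⇒equal {N} {M} {f} {g} df dg f≡g t =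
    i-j≡0⇒i≡j _ _ (vanishing-on-evens⇒zero difference (λ k → i≡j⇒i-j≡0 (f≡g k)) t)
    where
    difference : DegreeBelow (N ⊔ M) (λ t → f t - g t)
    difference = degreeBelow-cong (λ t → cong (λ z → f t + z) (-1*i≡-i (g t)))
      (degreeBelow-+ (degreeBelow-mono (ℕ.m≤m⊔n N M) df) (degreeBelow-*ˡ -1ℤ (degreeBelow-mono (ℕ.m≤n⊔m N M) dg)))

  eventually-zero⇒zero : ∀ {N f} T → DegreeBelow N f → (∀ t → f (T ℕ.+ t) ≡ 0ℤ) → ∀ t → f t ≡ 0ℤ
  eventually-zero⇒zero T (vanishing f≡0) _ = f≡0
  eventually-zero⇒zero {f = f} T (Δ-below dΔf) f-tail t = begin
    f t           ≡⟨ Δ≡0⇒constant f Δf≡0 t ⟩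
    f 0           ≡⟨ Δ≡0⇒constant f Δf≡0 (T ℕ.+ 0) ⟨
    f (T ℕ.+ 0)   ≡⟨ f-tail 0 ⟩
    0ℤ            ∎
    where
    Δf-tail : ∀ u → Δ f (T ℕ.+ u) ≡ 0ℤ
    Δf-tail u rewrite sym (ℕ.+-suc T u) | f-tail (suc u) | f-tail u = refl
    Δf≡0 : ∀ t → Δ f t ≡ 0ℤ
    Δf≡0 = eventually-zero⇒zero T dΔf Δf-tail

  record DegreeBelowᶻ (N : ℕ) (h : ℤ → ℤ) : Set where
    constructor degreeBelowᶻ
    field at : ∀ c → DegreeBelow N (λ t → h (c + + t))
  open DegreeBelowᶻ

  degreeBelowᶻ-cong : ∀ {N h k} → h ≗ k → DegreeBelowᶻ N h → DegreeBelowᶻ N k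
  degreeBelowᶻ-cong h≗k dh = degreeBelowᶻ (λ c → degreeBelow-cong (λ t → h≗k _) (at dh c))

  degreeBelowᶻ-mono : ∀ {N M h} → N ≤ M → DegreeBelowᶻ N h → DegreeBelowᶻ M h
  degreeBelowᶻ-mono N≤M dh = degreeBelowᶻ (λ c → degreeBelow-mono N≤M (at dh c))

  degreeBelowᶻ-const : ∀ a → DegreeBelowᶻ 1 (λ _ → a)
  degreeBelowᶻ-const a = degreeBelowᶻ (λ _ → degreeBelow-const a)

  degreeBelowᶻ-+ : ∀ {N h k} → DegreeBelowᶻ N h → DegreeBelowᶻ N k → DegreeBelowᶻ N (λ x → h x + k x)
  degreeBelowᶻ-+ dh dk = degreeBelowᶻ (λ c → degreeBelow-+ (at dh c) (at dk c))

  degreeBelowᶻ-*ˡ : ∀ {N} a {h} → DegreeBelowᶻ N h → DegreeBelowᶻ N (λ x → a * h x)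
  degreeBelowᶻ-*ˡ a dh = degreeBelowᶻ (λ c → degreeBelow-*ˡ a (at dh c))

  degreeBelowᶻ-*id : ∀ {N h} → DegreeBelowᶻ N h → DegreeBelowᶻ (suc N) (λ x → x * h x)
  degreeBelowᶻ-*id {h = h} dh = degreeBelowᶻ λ c →
    degreeBelow-cong (λ t → ring c (+ t) (h (c + + t)))
      (degreeBelow-+ (degreeBelow-suc (degreeBelow-*ˡ c (at dh c))) (degreeBelow-*id (at dh c)))
    where
    ring : ∀ c t a → c * a + t * a ≡ (c + t) * a
    ring = solve-∀

  degreeBelowᶻ-shift : ∀ {N} d {h} → DegreeBelowᶻ N h → DegreeBelowᶻ N (λ x → h (x + d))
  degreeBelowᶻ-shift d {h} dh = degreeBelowᶻ λ c →
    degreeBelow-cong (λ t → cong h (ring c d (+ t))) (at dh (c + d))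
    where
    ring : ∀ c d t → c + d + t ≡ c + t + d
    ring = solve-∀

  offset-dichotomy : ∀ x c → (∃ λ n → c ≡ x + + n) ⊎ (∃ λ n → x ≡ c + + n)
  offset-dichotomy x c with c - x in eq
  ... | + n      = inj₁ (n , trans (ring c x) (cong (λ d → x + d) eq))
    where
    ring : ∀ c x → c ≡ x + (c - x)
    ring = solve-∀
  ... | -[1+ n ] = inj₂ (suc n , trans (ring c x) (cong (λ d → c + - d) eq))
    where
    ring : ∀ c x → x ≡ c + - (c - x)
    ring = solve-∀

  vanishing-on-progressionᶻ⇒zero : ∀ {N h} → DegreeBelowᶻ N h → ∀ c →
    (∀ k → h (c + + (k ℕ.+ k)) ≡ 0ℤ) → ∀ x → h x ≡ 0ℤ
  vanishing-on-progressionᶻ⇒zero {h = h} dh c h-even x with offset-dichotomy x c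
  ... | inj₁ (n , refl) =
    trans (cong h (sym (+-identityʳ x)))
          (eventually-zero⇒zero n (at dh x) (λ t → trans (cong h (regroup t)) (h-right t)) 0)
    where
    h-right : ∀ t → h (x + + n + + t) ≡ 0ℤ
    h-right = vanishing-on-evens⇒zero (at dh (x + + n)) h-even
    regroup : ∀ t → x + + (n ℕ.+ t) ≡ x + + n + + t
    regroup t = trans (cong (λ s → x + s) (pos-+ n t)) (sym (+-assoc x (+ n) (+ t)))
  ... | inj₂ (n , refl) = vanishing-on-evens⇒zero (at dh c) h-even n

  degreeBelowᶻ-eval1 : ∀ p → DegreeBelowᶻ (length p) (eval1 p)
  degreeBelowᶻ-eval1 []       = degreeBelowᶻ (λ _ → vanishing (λ _ → refl))
  degreeBelowᶻ-eval1 (a ∷ as) =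
    degreeBelowᶻ-+ (degreeBelowᶻ-mono (ℕ.s≤s ℕ.z≤n) (degreeBelowᶻ-const a)) (degreeBelowᶻ-*id (degreeBelowᶻ-eval1 as))

  record DegreeBelow² (N : ℕ) (f : ℤ → ℤ → ℤ) : Set where
    constructor degreeBelow²
    field
      in-x : ∀ y → DegreeBelowᶻ N (λ x → f x y)
      in-y : ∀ x → DegreeBelowᶻ N (f x)
  open DegreeBelow²

  degreeBelow²-mono : ∀ {N M f} → N ≤ M → DegreeBelow² N f → DegreeBelow² M f
  degreeBelow²-mono N≤M df =
    degreeBelow² (λ y → degreeBelowᶻ-mono N≤M (in-x df y)) (λ x → degreeBelowᶻ-mono N≤M (in-y df x))

  Polynomial² : (ℤ → ℤ → ℤ) → Set
  Polynomial² f = ∃ λ N → DegreeBelow² N f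

  polynomial²-cong : ∀ {f g} → (∀ x y → f x y ≡ g x y) → Polynomial² f → Polynomial² g
  polynomial²-cong f≗g (N , df) =
    N , degreeBelow² (λ y → degreeBelowᶻ-cong (λ x → f≗g x y) (in-x df y)) (λ x → degreeBelowᶻ-cong (f≗g x) (in-y df x))

  polynomial²-+ : ∀ {f g} → Polynomial² f → Polynomial² g → Polynomial² (λ x y → f x y + g x y)
  polynomial²-+ {f} {g} (N , df) (M , dg) =
    N ⊔ M , degreeBelow² (λ y → degreeBelowᶻ-+ (in-x df′ y) (in-x dg′ y)) (λ x → degreeBelowᶻ-+ (in-y df′ x) (in-y dg′ x))
    where
    df′ : DegreeBelow² (N ⊔ M) f
    df′ = degreeBelow²-mono (ℕ.m≤m⊔n N M) df
    dg′ : DegreeBelow² (N ⊔ M) g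
    dg′ = degreeBelow²-mono (ℕ.m≤n⊔m N M) dg

  polynomial²-*ˡ : ∀ a {f} → Polynomial² f → Polynomial² (λ x y → a * f x y)
  polynomial²-*ˡ a (N , df) = N , degreeBelow² (λ y → degreeBelowᶻ-*ˡ a (in-x df y)) (λ x → degreeBelowᶻ-*ˡ a (in-y df x))

  polynomial²-difference : ∀ {f g} → Polynomial² f → Polynomial² g → Polynomial² (λ x y → f x y - g x y)
  polynomial²-difference {f} {g} pf pg =
    polynomial²-cong (λ x y → cong (λ z → f x y + z) (-1*i≡-i (g x y))) (polynomial²-+ pf (polynomial²-*ˡ -1ℤ pg))

  polynomial²-x* : ∀ {f} → Polynomial² f → Polynomial² (λ x y → x * f x y)
  polynomial²-x* (N , df) =
    suc N , degreeBelow² (λ y → degreeBelowᶻ-*id (in-x df y))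
                         (λ x → degreeBelowᶻ-mono (ℕ.n≤1+n N) (degreeBelowᶻ-*ˡ x (in-y df x)))

  polynomial²-y* : ∀ {f} → Polynomial² f → Polynomial² (λ x y → y * f x y)
  polynomial²-y* (N , df) =
    suc N , degreeBelow² (λ y → degreeBelowᶻ-mono (ℕ.n≤1+n N) (degreeBelowᶻ-*ˡ y (in-x df y)))
                         (λ x → degreeBelowᶻ-*id (in-y df x))

  polynomial²-shift : ∀ a b {f} → Polynomial² f → Polynomial² (λ x y → f (x + a) (y + b))
  polynomial²-shift a b (N , df) =
    N , degreeBelow² (λ y → degreeBelowᶻ-shift a (in-x df (y + b))) (λ x → degreeBelowᶻ-shift b (in-y df (x + a)))

  polynomial²-eval2 : ∀ p → Polynomial² (eval2 p)
  polynomial²-eval2 []       = 0 , degreeBelow² (λ _ → zero-fn) (λ _ → zero-fn)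
    where zero-fn = degreeBelowᶻ (λ _ → vanishing (λ _ → refl))
  polynomial²-eval2 (p ∷ ps) = polynomial²-+ constant-in-x (polynomial²-x* (polynomial²-eval2 ps))
    where
    constant-in-x : Polynomial² (λ x y → eval1 p y)
    constant-in-x = 1 ⊔ length p , degreeBelow²
      (λ y → degreeBelowᶻ-mono (ℕ.m≤m⊔n 1 (length p)) (degreeBelowᶻ-const (eval1 p y)))
      (λ x → degreeBelowᶻ-mono (ℕ.m≤n⊔m 1 (length p)) (degreeBelowᶻ-eval1 p))

  vanishing-on-lattice²⇒zero : ∀ {f} → Polynomial² f → ∀ r →
    (∀ m k → f (+ (m ℕ.+ (r ℕ.+ (k ℕ.+ k)))) (+ m) ≡ 0ℤ) → ∀ x y → f x y ≡ 0ℤ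
  vanishing-on-lattice²⇒zero {f} (N , df) r f≡0 x =
    vanishing-on-progressionᶻ⇒zero (in-y df x) 0ℤ (λ k → on-ℕ (k ℕ.+ k))
    where
    on-ℕ : ∀ m → f x (+ m) ≡ 0ℤ
    on-ℕ m = vanishing-on-progressionᶻ⇒zero (in-x df (+ m)) (+ (m ℕ.+ r))
      (λ k → trans (cong (λ s → f (+ s) (+ m)) (ℕ.+-assoc m r (k ℕ.+ k))) (f≡0 m k)) x

  agreeing-on-lattice²⇒equal : ∀ {f g} → Polynomial² f → Polynomial² g → ∀ r →
    (∀ m k → f (+ (m ℕ.+ (r ℕ.+ (k ℕ.+ k)))) (+ m) ≡ g (+ (m ℕ.+ (r ℕ.+ (k ℕ.+ k)))) (+ m)) → ∀ x y → f x y ≡ g x y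
  agreeing-on-lattice²⇒equal pf pg r f≡g x y =
    i-j≡0⇒i≡j _ _ (vanishing-on-lattice²⇒zero (polynomial²-difference pf pg) r (λ m k → i≡j⇒i-j≡0 (f≡g m k)) x y)

module Counting where

  open import Data.Nat using (ℕ; zero; suc; _+_; _*_)
  open import Data.Nat.Properties using (+-identityʳ)
  open import Data.Nat.Tactic.RingSolver using (solve-∀)
  open import Data.Nat.ListAction using (sum)
  open import Data.Nat.ListAction.Properties using (sum-++; sum-↭)
  open import Data.Integer using (ℤ)
  open import Data.Bool using (Bool; true; false; if_then_else_; _∧_; T)
  open import Data.Bool.Properties using (∧-zeroʳ)
  open import Data.Fin using (Fin; zero; suc; punchIn)
  open import Data.List using (List; []; _∷_; map; _++_; concat; filter; length)
  open import Data.List.Properties using (map-++; map-∘)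
  open import Data.List.Membership.Propositional using (_∈_)
  open import Data.List.Relation.Unary.Any using (here; there)
  open import Data.List.Relation.Binary.Permutation.Propositional using (_↭_)
  import Data.List.Relation.Binary.Permutation.Propositional.Properties as ↭
  open import Data.Vec using (Vec; []; _∷_; lookup; tabulate; insertAt)
  open import Function using (_∘_)
  open import Data.Empty using (⊥-elim)
  open import Relation.Binary.PropositionalEquality
  open import Relation.Nullary using (does)
  open import Relation.Unary using (Decidable)
  open import Defs using (allMaps; SignedGraph; numProperColourings; isProper)

  private
    variable
      A B : Set

  ∑ : List A → (A → ℕ) → ℕ
  ∑ xs f = sum (map f xs)

  syntax ∑ xs (λ x → e) = ∑[ x ∈ xs ] e

  ∑-zero : ∀ (xs : List A) → ∑[ x ∈ xs ] 0 ≡ 0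
  ∑-zero []       = refl
  ∑-zero (x ∷ xs) = ∑-zero xs

  ∑-cong : ∀ xs {f g : A → ℕ} → (∀ x → x ∈ xs → f x ≡ g x) → ∑ xs f ≡ ∑ xs g
  ∑-cong []       f≗g = refl
  ∑-cong (x ∷ xs) f≗g = cong₂ _+_ (f≗g x (here refl)) (∑-cong xs (λ y y∈xs → f≗g y (there y∈xs)))

  ∑-++ : ∀ xs ys (f : A → ℕ) → ∑ (xs ++ ys) f ≡ ∑ xs f + ∑ ys f
  ∑-++ xs ys f = trans (cong sum (map-++ f xs ys)) (sum-++ (map f xs) (map f ys))

  ∑-map : ∀ xs (g : A → B) f → ∑ (map g xs) f ≡ ∑ xs (f ∘ g)
  ∑-map xs g f = cong sum (sym (map-∘ xs))

  ∑-↭ : ∀ {xs ys} (f : A → ℕ) → xs ↭ ys → ∑ xs f ≡ ∑ ys f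
  ∑-↭ f xs↭ys = sum-↭ (↭.map⁺ f xs↭ys)

  ∑-concat : ∀ (xss : List (List A)) f → ∑ (concat xss) f ≡ ∑[ xs ∈ xss ] ∑ xs f
  ∑-concat []         f = refl
  ∑-concat (xs ∷ xss) f = trans (∑-++ xs (concat xss) f) (cong (∑ xs f +_) (∑-concat xss f))

  ∑-+ : ∀ xs (f g : A → ℕ) → ∑[ x ∈ xs ] (f x + g x) ≡ ∑ xs f + ∑ xs g
  ∑-+ []       f g = refl
  ∑-+ (x ∷ xs) f g rewrite ∑-+ xs f g = shuffle (f x) (g x) (∑ xs f) (∑ xs g)
    where
    shuffle : ∀ a b c d → (a + b) + (c + d) ≡ (a + c) + (b + d)
    shuffle = solve-∀

  ∑-swap : ∀ xs (ys : List B) (f : A → B → ℕ) →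
    ∑[ x ∈ xs ] ∑[ y ∈ ys ] f x y ≡ ∑[ y ∈ ys ] ∑[ x ∈ xs ] f x y
  ∑-swap []       ys f = sym (∑-zero ys)
  ∑-swap (x ∷ xs) ys f =
    trans (cong (∑ ys (f x) +_) (∑-swap xs ys f)) (sym (∑-+ ys (f x) (λ y → ∑[ x ∈ xs ] f x y)))

  indicator : Bool → ℕ
  indicator b = if b then 1 else 0

  T-ext : ∀ {a b} → (T a → T b) → (T b → T a) → a ≡ b
  T-ext {true}  {true}  _  _    = refl
  T-ext {true}  {false} to _    = ⊥-elim (to _)
  T-ext {false} {true}  _  from = ⊥-elim (from _)
  T-ext {false} {false} _  _    = refl

  count : ∀ n → (Fin n → List ℤ) → (Vec ℤ n → Bool) → ℕ
  count zero    L P = indicator (P [])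
  count (suc n) L P = ∑[ c ∈ L zero ] count n (L ∘ suc) (P ∘ (c ∷_))

  Admissible : ∀ {n} → (Fin n → List ℤ) → Vec ℤ n → Set
  Admissible L κ = ∀ i → lookup κ i ∈ L i

  admissible-∷ : ∀ {n} {L : Fin (suc n) → List ℤ} {c κ} →
    c ∈ L zero → Admissible (L ∘ suc) κ → Admissible L (c ∷ κ)
  admissible-∷ c∈L κ∈L zero    = c∈L
  admissible-∷ c∈L κ∈L (suc i) = κ∈L i

  count-cong : ∀ n L {P Q} → (∀ κ → Admissible L κ → P κ ≡ Q κ) → count n L P ≡ count n L Q
  count-cong zero    L P≗Q = cong indicator (P≗Q [] (λ ()))
  count-cong (suc n) L P≗Q = ∑-cong (L zero) λ c c∈L →
    count-cong n (L ∘ suc) (λ κ κ∈L → P≗Q (c ∷ κ) (admissible-∷ c∈L κ∈L))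

  count-lists-cong : ∀ n {L L′} P → (∀ i → L i ≡ L′ i) → count n L P ≡ count n L′ P
  count-lists-cong zero    P L≗L′ = refl
  count-lists-cong (suc n) {L} {L′} P L≗L′ =
    trans (cong (λ cs → ∑ cs _) (L≗L′ zero)) (∑-cong (L′ zero) (λ c _ → count-lists-cong n _ (L≗L′ ∘ suc)))

  count-↭ : ∀ n {L L′} P → (∀ i → L i ↭ L′ i) → count n L P ≡ count n L′ P
  count-↭ zero    P L↭L′ = refl
  count-↭ (suc n) {L} {L′} P L↭L′ =
    trans (∑-↭ _ (L↭L′ zero)) (∑-cong (L′ zero) (λ c _ → count-↭ n _ (L↭L′ ∘ suc)))

  count-map : ∀ n (π : Fin n → ℤ → ℤ) L P →
    count n (λ i → map (π i) (L i)) P ≡ count n L (λ κ → P (tabulate (λ i → π i (lookup κ i))))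
  count-map zero    π L P = refl
  count-map (suc n) π L P =
    trans (∑-map (L zero) (π zero) _) (∑-cong (L zero) (λ c _ → count-map n (π ∘ suc) (L ∘ suc) _))

  count-false : ∀ n L {P} → (∀ κ → Admissible L κ → P κ ≡ false) → count n L P ≡ 0
  count-false n L P≡false = trans (count-cong n L P≡false) (none n L)
    where
    none : ∀ n L → count n L (λ _ → false) ≡ 0
    none zero    L = refl
    none (suc n) L = trans (∑-cong (L zero) (λ _ _ → none n (L ∘ suc))) (∑-zero (L zero))

  count-∧ˡ : ∀ n L b P → count n L (λ κ → b ∧ P κ) ≡ indicator b * count n L P
  count-∧ˡ n L true  P = sym (+-identityʳ _)
  count-∧ˡ n L false P = count-false n L (λ _ _ → refl)

  count-insertAt : ∀ n (v : Fin (suc n)) L P →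
    count (suc n) L P ≡ ∑[ c ∈ L v ] count n (L ∘ punchIn v) (λ κ → P (insertAt κ v c))
  count-insertAt n       zero    L P = refl
  count-insertAt (suc n) (suc v) L P =
    trans (∑-cong (L zero) (λ c _ → count-insertAt n v (L ∘ suc) (P ∘ (c ∷_))))
          (∑-swap (L zero) (L (suc v)) _)

  allᵛ : ∀ {n} → (ℤ → Bool) → Vec ℤ n → Bool
  allᵛ D []      = true
  allᵛ D (x ∷ κ) = D x ∧ allᵛ D κ

  ∑-filter : ∀ {Q : ℤ → Set} (Q? : Decidable Q) xs f → ∑[ x ∈ xs ] (if does (Q? x) then f x else 0) ≡ ∑ (filter Q? xs) f
  ∑-filter Q? []       f = refl
  ∑-filter Q? (x ∷ xs) f with does (Q? x)
  ... | true  = cong (f x +_) (∑-filter Q? xs f)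
  ... | false = ∑-filter Q? xs f

  count-allᵛ : ∀ n L P {Q : ℤ → Set} (Q? : Decidable Q) →
    count n L (λ κ → P κ ∧ allᵛ (does ∘ Q?) κ) ≡ count n (filter Q? ∘ L) P
  count-allᵛ zero    L P Q? with P []
  ... | true  = refl
  ... | false = refl
  count-allᵛ (suc n) L P Q? = trans (∑-cong (L zero) (λ c _ → first c)) (∑-filter Q? (L zero) _)
    where
    first : ∀ c → count n (L ∘ suc) (λ κ → P (c ∷ κ) ∧ (does (Q? c) ∧ allᵛ (does ∘ Q?) κ)) ≡
                  (if does (Q? c) then count n (filter Q? ∘ L ∘ suc) (P ∘ (c ∷_)) else 0)
    first c with does (Q? c)
    ... | true  = count-allᵛ n (L ∘ suc) (P ∘ (c ∷_)) Q?
    ... | false = count-false n (L ∘ suc) (λ κ _ → ∧-zeroʳ (P (c ∷ κ)))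

  length-filter≡∑ : ∀ (Q : A → Bool) xs →
    length (filter (λ x → Q x Data.Bool.≟ true) xs) ≡ ∑[ x ∈ xs ] indicator (Q x)
  length-filter≡∑ Q []       = refl
  length-filter≡∑ Q (x ∷ xs) with Q x
  ... | true  = cong suc (length-filter≡∑ Q xs)
  ... | false = length-filter≡∑ Q xs

  ∑-allMaps : ∀ C n (Q : Vec ℤ n → Bool) → ∑[ κ ∈ allMaps C n ] indicator (Q κ) ≡ count n (λ _ → C) Q
  ∑-allMaps C zero    Q = +-identityʳ _
  ∑-allMaps C (suc n) Q =
    trans (∑-concat (map (λ c → map (c ∷_) (allMaps C n)) C) _)
    (trans (∑-map C (λ c → map (c ∷_) (allMaps C n)) _)
    (∑-cong C (λ c _ → trans (∑-map (allMaps C n) (c ∷_) _) (∑-allMaps C n (Q ∘ (c ∷_))))))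

  numProperColourings≡count : ∀ {n} (G : SignedGraph n) C → numProperColourings G C ≡ count n (λ _ → C) (isProper G)
  numProperColourings≡count {n} G C = trans (length-filter≡∑ (isProper G) (allMaps C n)) (∑-allMaps C n (isProper G))

module ColourSets where

  open import Data.Nat as ℕ using (ℕ; zero; suc; _∸_; _%_)
  import Data.Nat.Properties as ℕ
  open import Data.Integer using (ℤ; +_; -[1+_]; 0ℤ; -_; _≟_)
  open import Data.Integer.Properties using (neg-involutive; neg-injective; +-injective)
  open import Data.List using (List; []; _∷_; _++_; length; map; filter; applyUpTo)
  open import Data.List.Properties using (filter-accept; filter-reject; filter-all; length-++; length-applyUpTo)
  open import Data.List.Membership.Propositional using (_∈_; _∉_)
  open import Data.List.Membership.Propositional.Properties
    using (∈-filter⁻; ∈-filter⁺; ∈-++⁻; ∈-++⁺ˡ; ∈-++⁺ʳ; ++-∈⇔; ∈-map⁻; ∈-map⁺; ∈-applyUpTo⁻; ∈-applyUpTo⁺)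
  open import Data.List.Membership.Propositional.Properties.WithK using (unique∧set⇒bag)
  open import Data.List.Relation.Unary.Any using (here; there)
  open import Data.List.Relation.Unary.All as All using (All; []; _∷_)
  open import Data.List.Relation.Unary.AllPairs using ([]; _∷_)
  open import Data.List.Relation.Unary.Unique.Propositional using (Unique)
  import Data.List.Relation.Unary.Unique.Propositional.Properties as Unique
  open import Data.List.Relation.Binary.Permutation.Propositional using (_↭_)
  open import Data.List.Relation.Binary.BagAndSetEquality using (∼bag⇒↭)
  open import Data.Product using (Σ; ∃; _×_; _,_; proj₁; proj₂)
  open import Data.Sum using (_⊎_; inj₁; inj₂; [_,_]′)
  open import Data.Empty using (⊥; ⊥-elim)
  open import Function using (_∘_; _⇔_; mk⇔; Equivalence; case_of_)
  open import Relation.Binary.PropositionalEquality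
  open import Relation.Nullary using (¬?; yes; no)
  open import Defs using (IsColourSet)
  open FiniteDifferences using (x≡-x⇒x≡0)

  infixl 5 _∖_

  _∖_ : List ℤ → ℤ → List ℤ
  xs ∖ d = filter (λ x → ¬? (x ≟ d)) xs

  ∈-∖⁻ : ∀ {x d} xs → x ∈ xs ∖ d → x ∈ xs × x ≢ d
  ∈-∖⁻ xs = ∈-filter⁻ (λ x → ¬? (x ≟ _))

  ∈-∖⁺ : ∀ {x d xs} → x ∈ xs → x ≢ d → x ∈ xs ∖ d
  ∈-∖⁺ = ∈-filter⁺ (λ x → ¬? (x ≟ _))

  ∖-unique : ∀ {xs} d → Unique xs → Unique (xs ∖ d)
  ∖-unique d = Unique.filter⁺ (λ x → ¬? (x ≟ d))

  ∖-∉ : ∀ {d} xs → d ∉ xs → xs ∖ d ≡ xs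
  ∖-∉ xs d∉xs = filter-all (λ x → ¬? (x ≟ _)) (All.tabulate (λ x∈xs x≡d → d∉xs (subst (_∈ xs) x≡d x∈xs)))

  length-∖ : ∀ {d xs} → Unique xs → d ∈ xs → suc (length (xs ∖ d)) ≡ length xs
  length-∖ {d} {y ∷ ys} (y∉ys ∷ _) (here refl) =
    trans (cong (suc ∘ length) (filter-reject (λ x → ¬? (x ≟ d)) (λ y≢y → y≢y refl)))
          (cong (suc ∘ length) (∖-∉ ys (λ y∈ys → All.lookup y∉ys y∈ys refl)))
  length-∖ {d} {y ∷ ys} (y∉ys ∷ u) (there d∈ys) =
    trans (cong (suc ∘ length) (filter-accept (λ x → ¬? (x ≟ d)) (λ y≡d → All.lookup y∉ys d∈ys y≡d)))
          (cong suc (length-∖ u d∈ys))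

  record Decomposition (C : List ℤ) : Set where
    field
      Z P U           : List ℤ
      Z-shape         : Z ≡ [] ⊎ Z ≡ 0ℤ ∷ []
      unique-C        : Unique C
      unique-P        : Unique P
      unique-U        : Unique U
      P-nonzero       : ∀ {x} → x ∈ P → x ≢ 0ℤ
      U-nonzero       : ∀ {x} → x ∈ U → x ≢ 0ℤ
      P-disjoint-U    : ∀ {x} → x ∈ P → x ∉ U
      P-symmetric     : ∀ {x} → x ∈ P → - x ∈ P
      U-antisymmetric : ∀ {x} → x ∈ U → - x ∉ U
      members         : ∀ {x} → x ∈ C ⇔ (x ∈ Z ⊎ x ∈ P ⊎ x ∈ U)

    shared unpaired : ℕ
    shared   = length (Z ++ P)
    unpaired = length U

    Z-zero : ∀ {x} → x ∈ Z → x ≡ 0ℤ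
    Z-zero x∈Z with Z-shape
    ... | inj₁ Z≡[]  rewrite Z≡[]  with () ← x∈Z
    ... | inj₂ Z≡[0] rewrite Z≡[0] with here x≡0 ← x∈Z = x≡0

    Z-neg : map -_ Z ≡ Z
    Z-neg with Z-shape
    ... | inj₁ Z≡[]  rewrite Z≡[]  = refl
    ... | inj₂ Z≡[0] rewrite Z≡[0] = refl

    unique-Z : Unique Z
    unique-Z with Z-shape
    ... | inj₁ Z≡[]  rewrite Z≡[]  = []
    ... | inj₂ Z≡[0] rewrite Z≡[0] = [] ∷ []

    ∈C : ∀ {x} → x ∈ Z ⊎ x ∈ P ⊎ x ∈ U → x ∈ C
    ∈C = Equivalence.from members

    C-cases : ∀ {x} → x ∈ C → x ∈ Z ⊎ x ∈ P ⊎ x ∈ U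
    C-cases = Equivalence.to members

    unique-Z++P : Unique (Z ++ P)
    unique-Z++P = Unique.++⁺ unique-Z unique-P (λ (x∈Z , x∈P) → P-nonzero x∈P (Z-zero x∈Z))

    private
      in-Z++P++U : ∀ {x} → x ∈ Z ++ P ++ U ⇔ (x ∈ Z ⊎ x ∈ P ⊎ x ∈ U)
      in-Z++P++U {x} = mk⇔ to from
        where
        to : x ∈ Z ++ P ++ U → x ∈ Z ⊎ x ∈ P ⊎ x ∈ U
        to x∈ with ∈-++⁻ Z x∈
        ... | inj₁ x∈Z = inj₁ x∈Z
        ... | inj₂ x∈P++U = inj₂ (∈-++⁻ P x∈P++U)
        from : x ∈ Z ⊎ x ∈ P ⊎ x ∈ U → x ∈ Z ++ P ++ U
        from (inj₁ x∈Z)        = ∈-++⁺ˡ x∈Z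
        from (inj₂ (inj₁ x∈P)) = ∈-++⁺ʳ Z (∈-++⁺ˡ x∈P)
        from (inj₂ (inj₂ x∈U)) = ∈-++⁺ʳ Z (∈-++⁺ʳ P x∈U)

    unique-Z++P++U : Unique (Z ++ P ++ U)
    unique-Z++P++U = Unique.++⁺ unique-Z (Unique.++⁺ unique-P unique-U (λ (x∈P , x∈U) → P-disjoint-U x∈P x∈U))
      λ (x∈Z , x∈P++U) →
        [ (λ x∈P → P-nonzero x∈P (Z-zero x∈Z)) , (λ x∈U → U-nonzero x∈U (Z-zero x∈Z)) ]′ (∈-++⁻ P x∈P++U)

    unique-Z++P++±U : Unique ((Z ++ P) ++ U ++ map -_ U)
    unique-Z++P++±U = Unique.++⁺ unique-Z++P
      (Unique.++⁺ unique-U (Unique.map⁺ neg-injective unique-U) λ (x∈U , x∈-U) → let y , y∈U , x≡-y = ∈-map⁻ -_ x∈-U in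
         U-antisymmetric y∈U (subst (_∈ U) x≡-y x∈U))
      λ (x∈Z++P , x∈±U) → shared-unpaired (∈-++⁻ Z x∈Z++P) (∈-++⁻ U x∈±U)
      where
      shared-unpaired : ∀ {x} → x ∈ Z ⊎ x ∈ P → x ∈ U ⊎ x ∈ map -_ U → ⊥
      shared-unpaired (inj₁ x∈Z) (inj₁ x∈U)  = U-nonzero x∈U (Z-zero x∈Z)
      shared-unpaired (inj₂ x∈P) (inj₁ x∈U)  = P-disjoint-U x∈P x∈U
      shared-unpaired (inj₁ x∈Z) (inj₂ x∈-U) with ∈-map⁻ -_ x∈-U
      ... | y , y∈U , refl = U-nonzero y∈U (trans (sym (neg-involutive y)) (cong -_ (Z-zero x∈Z)))
      shared-unpaired (inj₂ x∈P) (inj₂ x∈-U) with ∈-map⁻ -_ x∈-U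
      ... | y , y∈U , refl = P-disjoint-U (subst (_∈ P) (neg-involutive y) (P-symmetric x∈P)) y∈U

    C↭Z++P++U : C ↭ Z ++ P ++ U
    C↭Z++P++U = ∼bag⇒↭ (unique∧set⇒bag unique-C unique-Z++P++U
      (mk⇔ (Equivalence.from in-Z++P++U ∘ C-cases) (∈C ∘ Equivalence.to in-Z++P++U)))

    -P↭P : map -_ P ↭ P
    -P↭P = ∼bag⇒↭ (unique∧set⇒bag (Unique.map⁺ neg-injective unique-P) unique-P (mk⇔ to from))
      where
      to : ∀ {x} → x ∈ map -_ P → x ∈ P
      to x∈-P with ∈-map⁻ -_ x∈-P
      ... | y , y∈P , refl = P-symmetric y∈P
      from : ∀ {x} → x ∈ P → x ∈ map -_ P
      from {x} x∈P = subst (_∈ map -_ P) (neg-involutive x) (∈-map⁺ -_ (P-symmetric x∈P))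

  neg-swap : ∀ {x y} → - x ≡ y → x ≡ - y
  neg-swap {x} -x≡y = trans (sym (neg-involutive x)) (cong -_ -x≡y)

  x≢-x : ∀ {x} → x ≢ 0ℤ → x ≢ - x
  x≢-x x≢0 = x≢0 ∘ x≡-x⇒x≡0

  module _ {C : List ℤ} (d : Decomposition C) where
    open Decomposition d

    module RemovePair {p} (p∈P : p ∈ P) where

      P′ U′ : List ℤ
      P′ = (P ∖ - p) ∖ p
      U′ = - p ∷ U

      p≢0 : p ≢ 0ℤ
      p≢0 = P-nonzero p∈P
      -p∈P : - p ∈ P
      -p∈P = P-symmetric p∈P

      P′⊆P : ∀ {x} → x ∈ P′ → x ∈ P
      P′⊆P x∈P′ = proj₁ (∈-∖⁻ P (proj₁ (∈-∖⁻ (P ∖ - p) x∈P′)))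

      P′-excludes : ∀ {x} → x ∈ P′ → x ≢ p × x ≢ - p
      P′-excludes x∈P′ = proj₂ (∈-∖⁻ (P ∖ - p) x∈P′) , proj₂ (∈-∖⁻ P (proj₁ (∈-∖⁻ (P ∖ - p) x∈P′)))

      into-P′ : ∀ {x} → x ∈ P → x ≢ p → x ≢ - p → x ∈ P′
      into-P′ x∈P x≢p x≢-p = ∈-∖⁺ (∈-∖⁺ x∈P x≢-p) x≢p

      P′-symmetric : ∀ {x} → x ∈ P′ → - x ∈ P′
      P′-symmetric x∈P′ = into-P′ (P-symmetric (P′⊆P x∈P′))
        (λ -x≡p → proj₂ (P′-excludes x∈P′) (neg-swap -x≡p))
        (λ -x≡-p → proj₁ (P′-excludes x∈P′) (neg-injective -x≡-p))

      U′-nonzero : ∀ {x} → x ∈ U′ → x ≢ 0ℤ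
      U′-nonzero (here refl) -p≡0 = p≢0 (neg-swap -p≡0)
      U′-nonzero (there x∈U)      = U-nonzero x∈U

      P′-disjoint-U′ : ∀ {x} → x ∈ P′ → x ∉ U′
      P′-disjoint-U′ x∈P′ (here refl) = proj₂ (P′-excludes x∈P′) refl
      P′-disjoint-U′ x∈P′ (there x∈U) = P-disjoint-U (P′⊆P x∈P′) x∈U

      U′-antisymmetric : ∀ {x} → x ∈ U′ → - x ∉ U′
      U′-antisymmetric (here refl) (here p′≡-p) = x≢-x p≢0 (trans (sym (neg-involutive p)) p′≡-p)
      U′-antisymmetric (here refl) (there p′∈U) = P-disjoint-U p∈P (subst (_∈ U) (neg-involutive p) p′∈U)
      U′-antisymmetric (there x∈U) (here -x≡-p)  = P-disjoint-U p∈P (subst (_∈ U) (neg-injective -x≡-p) x∈U)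
      U′-antisymmetric (there x∈U) (there -x∈U)  = U-antisymmetric x∈U -x∈U

      to : ∀ {x} → x ∈ C ∖ p → x ∈ Z ⊎ x ∈ P′ ⊎ x ∈ U′
      to {x} x∈C∖p with ∈-∖⁻ C x∈C∖p
      ... | x∈C , x≢p with C-cases x∈C
      ...   | inj₁ x∈Z        = inj₁ x∈Z
      ...   | inj₂ (inj₂ x∈U) = inj₂ (inj₂ (there x∈U))
      ...   | inj₂ (inj₁ x∈P) with x ≟ - p
      ...     | yes x≡-p = inj₂ (inj₂ (here x≡-p))
      ...     | no  x≢-p = inj₂ (inj₁ (into-P′ x∈P x≢p x≢-p))

      from : ∀ {x} → x ∈ Z ⊎ x ∈ P′ ⊎ x ∈ U′ → x ∈ C ∖ p
      from (inj₁ x∈Z)                = ∈-∖⁺ (∈C (inj₁ x∈Z)) (λ x≡p → p≢0 (trans (sym x≡p) (Z-zero x∈Z)))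
      from (inj₂ (inj₁ x∈P′))        = ∈-∖⁺ (∈C (inj₂ (inj₁ (P′⊆P x∈P′)))) (proj₁ (P′-excludes x∈P′))
      from (inj₂ (inj₂ (here refl)))  = ∈-∖⁺ (∈C (inj₂ (inj₁ -p∈P))) (λ -p≡p → x≢-x p≢0 (sym -p≡p))
      from (inj₂ (inj₂ (there x∈U))) =
        ∈-∖⁺ (∈C (inj₂ (inj₂ x∈U))) (λ x≡p → P-disjoint-U p∈P (subst (_∈ U) x≡p x∈U))

      decomposition′ : Decomposition (C ∖ p)
      decomposition′ = record
        { Z = Z ; P = P′ ; U = U′
        ; Z-shape         = Z-shape
        ; unique-C        = ∖-unique p unique-C
        ; unique-P        = ∖-unique p (∖-unique (- p) unique-P)
        ; unique-U        = All.tabulate (λ x∈U -p≡x → P-disjoint-U -p∈P (subst (_∈ U) (sym -p≡x) x∈U)) ∷ unique-U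
        ; P-nonzero       = P-nonzero ∘ P′⊆P
        ; U-nonzero       = U′-nonzero
        ; P-disjoint-U    = P′-disjoint-U′
        ; P-symmetric     = P′-symmetric
        ; U-antisymmetric = U′-antisymmetric
        ; members         = mk⇔ to from
        }

      shared-decreases : 2 ℕ.+ length (Z ++ P′) ≡ length (Z ++ P)
      shared-decreases = begin
        2 ℕ.+ length (Z ++ P′)                  ≡⟨ cong (2 ℕ.+_) (length-++ Z) ⟩
        2 ℕ.+ (length Z ℕ.+ length P′)
          ≡⟨ sym (trans (ℕ.+-suc (length Z) (suc (length P′))) (cong suc (ℕ.+-suc (length Z) (length P′)))) ⟩
        length Z ℕ.+ suc (suc (length P′))
          ≡⟨ cong (λ n → length Z ℕ.+ suc n) (length-∖ (∖-unique (- p) unique-P) p∈P∖-p) ⟩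
        length Z ℕ.+ suc (length (P ∖ - p))     ≡⟨ cong (length Z ℕ.+_) (length-∖ unique-P -p∈P) ⟩
        length Z ℕ.+ length P                   ≡⟨ sym (length-++ Z) ⟩
        length (Z ++ P)                         ∎
        where
        open ≡-Reasoning
        p∈P∖-p : p ∈ P ∖ - p
        p∈P∖-p = ∈-∖⁺ p∈P (x≢-x p≢0)

    remove-pair : ∀ {p} → p ∈ P → Σ (Decomposition (C ∖ p)) λ d′ →
      2 ℕ.+ Decomposition.shared d′ ≡ shared × Decomposition.unpaired d′ ≡ suc unpaired
    remove-pair p∈P = decomposition′ , shared-decreases , refl
      where open RemovePair p∈P

    remove-unpaired : ∀ {u} → u ∈ U → Σ (Decomposition (C ∖ u)) λ d′ →
      Decomposition.shared d′ ≡ shared × suc (Decomposition.unpaired d′) ≡ unpaired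
    remove-unpaired {u} u∈U = record
      { Z = Z ; P = P ; U = U ∖ u
      ; Z-shape         = Z-shape
      ; unique-C        = ∖-unique u unique-C
      ; unique-P        = unique-P
      ; unique-U        = ∖-unique u unique-U
      ; P-nonzero       = P-nonzero
      ; U-nonzero       = U-nonzero ∘ U′⊆U
      ; P-disjoint-U    = λ x∈P x∈U′ → P-disjoint-U x∈P (U′⊆U x∈U′)
      ; P-symmetric     = P-symmetric
      ; U-antisymmetric = λ x∈U′ -x∈U′ → U-antisymmetric (U′⊆U x∈U′) (U′⊆U -x∈U′)
      ; members         = mk⇔ to from
      } , refl , length-∖ unique-U u∈U
      where
      U′⊆U : ∀ {x} → x ∈ U ∖ u → x ∈ U
      U′⊆U = proj₁ ∘ ∈-∖⁻ U
      to : ∀ {x} → x ∈ C ∖ u → x ∈ Z ⊎ x ∈ P ⊎ x ∈ U ∖ u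
      to x∈C∖u with ∈-∖⁻ C x∈C∖u
      ... | x∈C , x≢u with C-cases x∈C
      ...   | inj₁ x∈Z        = inj₁ x∈Z
      ...   | inj₂ (inj₁ x∈P) = inj₂ (inj₁ x∈P)
      ...   | inj₂ (inj₂ x∈U) = inj₂ (inj₂ (∈-∖⁺ x∈U x≢u))
      from : ∀ {x} → x ∈ Z ⊎ x ∈ P ⊎ x ∈ U ∖ u → x ∈ C ∖ u
      from (inj₁ x∈Z)         = ∈-∖⁺ (∈C (inj₁ x∈Z)) (λ x≡u → U-nonzero u∈U (trans (sym x≡u) (Z-zero x∈Z)))
      from (inj₂ (inj₁ x∈P))  = ∈-∖⁺ (∈C (inj₂ (inj₁ x∈P))) (λ x≡u → P-disjoint-U x∈P (subst (_∈ U) (sym x≡u) u∈U))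
      from (inj₂ (inj₂ x∈U′)) = ∈-∖⁺ (∈C (inj₂ (inj₂ (U′⊆U x∈U′)))) (proj₂ (∈-∖⁻ U x∈U′))

    remove-zero : 0ℤ ∈ Z → Σ (Decomposition (C ∖ 0ℤ)) λ d′ →
      suc (Decomposition.shared d′) ≡ shared × Decomposition.unpaired d′ ≡ unpaired
    remove-zero 0∈Z = record
      { Z = [] ; P = P ; U = U
      ; Z-shape         = inj₁ refl
      ; unique-C        = ∖-unique 0ℤ unique-C
      ; unique-P        = unique-P
      ; unique-U        = unique-U
      ; P-nonzero       = P-nonzero
      ; U-nonzero       = U-nonzero
      ; P-disjoint-U    = P-disjoint-U
      ; P-symmetric     = P-symmetric
      ; U-antisymmetric = U-antisymmetric
      ; members         = mk⇔ to from
      } , shared-decreases , refl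
      where
      to : ∀ {x} → x ∈ C ∖ 0ℤ → x ∈ [] ⊎ x ∈ P ⊎ x ∈ U
      to x∈C∖0 with ∈-∖⁻ C x∈C∖0
      ... | x∈C , x≢0 with C-cases x∈C
      ...   | inj₁ x∈Z      = ⊥-elim (x≢0 (Z-zero x∈Z))
      ...   | inj₂ x∈P⊎x∈U = inj₂ x∈P⊎x∈U
      shared-decreases : suc (length P) ≡ length (Z ++ P)
      shared-decreases with Z-shape
      ... | inj₁ Z≡[]  = ⊥-elim (case subst (0ℤ ∈_) Z≡[] 0∈Z of λ ())
      ... | inj₂ Z≡[0] = cong (λ Z → length (Z ++ P)) (sym Z≡[0])
      from : ∀ {x} → x ∈ [] ⊎ x ∈ P ⊎ x ∈ U → x ∈ C ∖ 0ℤ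
      from (inj₂ (inj₁ x∈P)) = ∈-∖⁺ (∈C (inj₂ (inj₁ x∈P))) (P-nonzero x∈P)
      from (inj₂ (inj₂ x∈U)) = ∈-∖⁺ (∈C (inj₂ (inj₂ x∈U))) (U-nonzero x∈U)

  decomposition : ∀ {l m C} → IsColourSet l m C → Σ (Decomposition C) λ d →
    Decomposition.shared d ≡ l ∸ m × Decomposition.unpaired d ≡ m × length (Decomposition.Z d) ≡ (l ∸ m) % 2
  decomposition (uC , P , U , uP , uU , nzP , nzU , dPU , clP , anU , |U| , inj₁ (even , |P| , C⇔)) =
    record
      { Z = [] ; P = P ; U = U ; Z-shape = inj₁ refl
      ; unique-C = uC ; unique-P = uP ; unique-U = uU
      ; P-nonzero = nzP _ ; U-nonzero = nzU _ ; P-disjoint-U = dPU _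
      ; P-symmetric = clP _ ; U-antisymmetric = anU _
      ; members = mk⇔ (inj₂ ∘ Equivalence.to (C⇔ _)) (λ { (inj₁ ()) ; (inj₂ x∈P⊎U) → Equivalence.from (C⇔ _) x∈P⊎U })
      } , |P| , |U| , sym even
  decomposition {l} {m} (uC , P , U , uP , uU , nzP , nzU , dPU , clP , anU , |U| , inj₂ (odd , |P| , C⇔)) =
    record
      { Z = 0ℤ ∷ [] ; P = P ; U = U ; Z-shape = inj₂ refl
      ; unique-C = uC ; unique-P = uP ; unique-U = uU
      ; P-nonzero = nzP _ ; U-nonzero = nzU _ ; P-disjoint-U = dPU _
      ; P-symmetric = clP _ ; U-antisymmetric = anU _
      ; members = mk⇔ (zero-first ∘ Equivalence.to (C⇔ _)) (Equivalence.from (C⇔ _) ∘ zero-last)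
      } , trans (cong suc |P|) (odd⇒suc-pred (l ∸ m) odd) , |U| , sym odd
    where
    odd⇒suc-pred : ∀ n → n % 2 ≡ 1 → suc (n ∸ 1) ≡ n
    odd⇒suc-pred (suc n) _ = refl
    zero-first : ∀ {x} → x ∈ P ⊎ x ∈ U ⊎ x ≡ 0ℤ → x ∈ 0ℤ ∷ [] ⊎ x ∈ P ⊎ x ∈ U
    zero-first (inj₁ x∈P)        = inj₂ (inj₁ x∈P)
    zero-first (inj₂ (inj₁ x∈U)) = inj₂ (inj₂ x∈U)
    zero-first (inj₂ (inj₂ x≡0)) = inj₁ (here x≡0)
    zero-last : ∀ {x} → x ∈ 0ℤ ∷ [] ⊎ x ∈ P ⊎ x ∈ U → x ∈ P ⊎ x ∈ U ⊎ x ≡ 0ℤ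
    zero-last (inj₁ (here x≡0))  = inj₂ (inj₂ x≡0)
    zero-last (inj₂ (inj₁ x∈P)) = inj₁ x∈P
    zero-last (inj₂ (inj₂ x∈U)) = inj₂ (inj₁ x∈U)

  module CanonicalColours (k m : ℕ) where

    P U : List ℤ
    P = applyUpTo (+_ ∘ suc) k ++ applyUpTo -[1+_] k
    U = applyUpTo (λ j → + suc (k ℕ.+ j)) m

    P-member : ∀ {x} → x ∈ P → ∃ λ j → j ℕ.< k × (x ≡ + suc j ⊎ x ≡ -[1+ j ])
    P-member x∈P with ∈-++⁻ (applyUpTo (+_ ∘ suc) k) x∈P
    ... | inj₁ x∈pos = let j , j<k , x≡ = ∈-applyUpTo⁻ (+_ ∘ suc) x∈pos in j , j<k , inj₁ x≡
    ... | inj₂ x∈neg = let j , j<k , x≡ = ∈-applyUpTo⁻ -[1+_] x∈neg in j , j<k , inj₂ x≡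

    U-member : ∀ {x} → x ∈ U → ∃ λ j → x ≡ + suc (k ℕ.+ j)
    U-member x∈U = let j , _ , x≡ = ∈-applyUpTo⁻ (λ j → + suc (k ℕ.+ j)) x∈U in j , x≡

    unique-P : Unique P
    unique-P = Unique.++⁺
      (Unique.applyUpTo⁺₁ (+_ ∘ suc) k (λ { i<j _ refl → ℕ.<-irrefl refl i<j }))
      (Unique.applyUpTo⁺₁ -[1+_] k (λ { i<j _ refl → ℕ.<-irrefl refl i<j }))
      (λ (x∈pos , x∈neg) → pos≢neg (trans (sym (proj₂ (proj₂ (∈-applyUpTo⁻ (+_ ∘ suc) x∈pos))))
                                           (proj₂ (proj₂ (∈-applyUpTo⁻ -[1+_] x∈neg)))))
      where
      pos≢neg : ∀ {i j} → + suc i ≢ -[1+ j ]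
      pos≢neg ()

    unique-U : Unique U
    unique-U = Unique.applyUpTo⁺₁ _ m λ i<j _ eq →
      ℕ.<-irrefl (ℕ.+-cancelˡ-≡ k _ _ (ℕ.suc-injective (+-injective eq))) i<j

    P-nonzero : ∀ {x} → x ∈ P → x ≢ 0ℤ
    P-nonzero x∈P x≡0 with P-member x∈P
    ... | _ , _ , inj₁ x≡ with () ← trans (sym x≡0) x≡
    ... | _ , _ , inj₂ x≡ with () ← trans (sym x≡0) x≡

    U-nonzero : ∀ {x} → x ∈ U → x ≢ 0ℤ
    U-nonzero x∈U x≡0 with () ← trans (sym x≡0) (proj₂ (U-member x∈U))

    P-disjoint-U : ∀ {x} → x ∈ P → x ∉ U
    P-disjoint-U x∈P x∈U with P-member x∈P | U-member x∈U
    ... | j , j<k , inj₁ refl | i , x≡ =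
      ℕ.<-irrefl refl (ℕ.≤-trans j<k (subst (k ℕ.≤_) (sym (ℕ.suc-injective (+-injective x≡))) (ℕ.m≤m+n k i)))
    ... | j , j<k , inj₂ refl | i , ()

    P-symmetric : ∀ {x} → x ∈ P → - x ∈ P
    P-symmetric x∈P with P-member x∈P
    ... | j , j<k , inj₁ refl = ∈-++⁺ʳ (applyUpTo (+_ ∘ suc) k) (∈-applyUpTo⁺ -[1+_] j<k)
    ... | j , j<k , inj₂ refl = ∈-++⁺ˡ (∈-applyUpTo⁺ (+_ ∘ suc) j<k)

    U-antisymmetric : ∀ {x} → x ∈ U → - x ∉ U
    U-antisymmetric x∈U -x∈U with U-member x∈U | U-member -x∈U
    ... | i , refl | j , ()

    length-P : length P ≡ k ℕ.+ k
    length-P = trans (length-++ (applyUpTo (+_ ∘ suc) k)) (cong₂ ℕ._+_ (length-applyUpTo _ k) (length-applyUpTo _ k))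

    unique-P++U : Unique (P ++ U)
    unique-P++U = Unique.++⁺ unique-P unique-U (λ (x∈P , x∈U) → P-disjoint-U x∈P x∈U)

  even-%2 : ∀ k → (k ℕ.+ k) % 2 ≡ 0
  even-%2 zero    = refl
  even-%2 (suc k) rewrite ℕ.+-suc k k = even-%2 k

  odd-%2 : ∀ k → suc (k ℕ.+ k) % 2 ≡ 1
  odd-%2 zero    = refl
  odd-%2 (suc k) rewrite ℕ.+-suc k k = odd-%2 k

  colourSet-even : ∀ m k → ∃ (IsColourSet (m ℕ.+ (k ℕ.+ k)) m)
  colourSet-even m k =
    P ++ U , unique-P++U , P , U , unique-P , unique-U , (λ _ → P-nonzero) , (λ _ → U-nonzero) ,
    (λ _ → P-disjoint-U) , (λ _ → P-symmetric) , (λ _ → U-antisymmetric) , length-applyUpTo _ m ,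
    inj₁ ( subst (λ n → n % 2 ≡ 0) (sym m+2k∸m) (even-%2 k) , trans length-P (sym m+2k∸m) , λ _ → ++-∈⇔)
    where
    open CanonicalColours k m
    m+2k∸m : m ℕ.+ (k ℕ.+ k) ∸ m ≡ k ℕ.+ k
    m+2k∸m = ℕ.m+n∸m≡n m (k ℕ.+ k)

  colourSet-odd : ∀ m k → ∃ (IsColourSet (m ℕ.+ suc (k ℕ.+ k)) m)
  colourSet-odd m k =
    0ℤ ∷ P ++ U , All.tabulate (λ x∈P++U 0≡x → nonzero x∈P++U (sym 0≡x)) ∷ unique-P++U ,
    P , U , unique-P , unique-U , (λ _ → P-nonzero) , (λ _ → U-nonzero) ,
    (λ _ → P-disjoint-U) , (λ _ → P-symmetric) , (λ _ → U-antisymmetric) , length-applyUpTo _ m ,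
    inj₂ ( subst (λ n → n % 2 ≡ 1) (sym m+2k+1∸m) (odd-%2 k) , trans length-P (cong (_∸ 1) (sym m+2k+1∸m))
         , λ _ → mk⇔ to from)
    where
    open CanonicalColours k m
    m+2k+1∸m : m ℕ.+ suc (k ℕ.+ k) ∸ m ≡ suc (k ℕ.+ k)
    m+2k+1∸m = ℕ.m+n∸m≡n m (suc (k ℕ.+ k))
    nonzero : ∀ {x} → x ∈ P ++ U → x ≢ 0ℤ
    nonzero x∈P++U with ∈-++⁻ P x∈P++U
    ... | inj₁ x∈P = P-nonzero x∈P
    ... | inj₂ x∈U = U-nonzero x∈U
    to : ∀ {x} → x ∈ 0ℤ ∷ P ++ U → x ∈ P ⊎ x ∈ U ⊎ x ≡ 0ℤ
    to (here x≡0)      = inj₂ (inj₂ x≡0)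
    to (there x∈P++U)  with ∈-++⁻ P x∈P++U
    ... | inj₁ x∈P = inj₁ x∈P
    ... | inj₂ x∈U = inj₂ (inj₁ x∈U)
    from : ∀ {x} → x ∈ P ⊎ x ∈ U ⊎ x ≡ 0ℤ → x ∈ 0ℤ ∷ P ++ U
    from (inj₁ x∈P)        = there (∈-++⁺ˡ x∈P)
    from (inj₂ (inj₁ x∈U)) = there (∈-++⁺ʳ P x∈U)
    from (inj₂ (inj₂ x≡0)) = here x≡0

module Balance where

  open import Data.Nat as ℕ using (ℕ; zero; suc; _<_; _≤_; s≤s; _%_)
  import Data.Nat.Properties as ℕ
  open import Data.Fin using (Fin; zero; suc; inject₁; fromℕ)
  open import Data.Fin.Properties using (_≟_)
  open import Data.Maybe using (Maybe; just; nothing)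
  open import Data.Sign as Sign using (Sign; opposite)
  import Data.Sign.Properties as Sign
  open import Data.List as List using (List; []; _∷_; _++_; [_]; length)
  import Data.List.Properties as List
  open import Data.Nat.ListAction using (sum)
  open import Data.List.Membership.Propositional.Properties using (∈-∃++; ∈-lookup)
  open import Data.List.Relation.Unary.All as All using (All; []; _∷_)
  open import Data.List.Relation.Unary.All.Properties using (¬Any⇒All¬)
  open import Data.List.Relation.Unary.AllPairs using ([]; _∷_)
  open import Data.List.Relation.Unary.Unique.Propositional using (Unique)
  open import Data.Product using (∃; _×_; _,_; proj₁; proj₂)
  open import Data.Sum using (_⊎_; inj₁; inj₂)
  open import Data.Unit using (⊤; tt)
  open import Data.Empty using (⊥-elim)
  open import Function using (_∘_; id)
  open import Relation.Binary.PropositionalEquality hiding ([_])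
  open import Relation.Nullary using (yes; no)
  open import Defs

  signOf : Maybe Sign → Sign
  signOf (just s) = s
  signOf nothing  = Sign.+

  parity : ℕ → Sign
  parity zero    = Sign.+
  parity (suc k) = opposite (parity k)

  parity-+ : ∀ a b → parity (a ℕ.+ b) ≡ parity a Sign.* parity b
  parity-+ zero    b = refl
  parity-+ (suc a) b rewrite parity-+ a b = opposite-* (parity a) (parity b)
    where
    opposite-* : ∀ s t → opposite (s Sign.* t) ≡ opposite s Sign.* t
    opposite-* Sign.+ t = refl
    opposite-* Sign.- t = Sign.opposite-involutive t

  parity-isNeg : ∀ e → parity (isNeg e) ≡ signOf e
  parity-isNeg (just Sign.-) = refl
  parity-isNeg (just Sign.+) = refl
  parity-isNeg nothing       = refl

  parity-even : ∀ k → k % 2 ≡ 0 → parity k ≡ Sign.+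
  parity-even zero          _ = refl
  parity-even (suc (suc k)) e rewrite parity-even k e = refl

  module _ {n : ℕ} (G : SignedGraph n) where

    IsWalk : List (Fin n) → Set
    IsWalk []            = ⊤
    IsWalk (x ∷ [])      = ⊤
    IsWalk (x ∷ y ∷ ys) = IsEdge (edge G x y) × IsWalk (y ∷ ys)

    walkSign : List (Fin n) → Sign
    walkSign []            = Sign.+
    walkSign (x ∷ [])      = Sign.+
    walkSign (x ∷ y ∷ ys) = signOf (edge G x y) Sign.* walkSign (y ∷ ys)

    closed : List (Fin n) → List (Fin n)
    closed []       = []
    closed (y ∷ ys) = y ∷ ys ++ [ y ]

    ClosedWalksPositive : Set
    ClosedWalksPositive = ∀ ys → IsWalk (closed ys) → walkSign (closed ys) ≡ Sign.+

    walkSign-++ : ∀ xs x ys → walkSign (xs ++ x ∷ ys) ≡ walkSign (xs ++ [ x ]) Sign.* walkSign (x ∷ ys)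
    walkSign-++ []           x ys = refl
    walkSign-++ (a ∷ [])     x ys = cong (Sign._* walkSign (x ∷ ys)) (sym (Sign.*-identityʳ (signOf (edge G a x))))
    walkSign-++ (a ∷ b ∷ xs) x ys =
      trans (cong (signOf (edge G a b) Sign.*_) (walkSign-++ (b ∷ xs) x ys))
            (sym (Sign.*-assoc (signOf (edge G a b)) _ _))

    isWalk-++⁻ : ∀ xs x ys → IsWalk (xs ++ x ∷ ys) → IsWalk (xs ++ [ x ]) × IsWalk (x ∷ ys)
    isWalk-++⁻ []           x ys w             = tt , w
    isWalk-++⁻ (a ∷ [])     x ys (e , w)       = (e , tt) , w
    isWalk-++⁻ (a ∷ b ∷ xs) x ys (e , w) with isWalk-++⁻ (b ∷ xs) x ys w
    ... | w₁ , w₂ = (e , w₁) , w₂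

    isWalk-++⁺ : ∀ xs x ys → IsWalk (xs ++ [ x ]) → IsWalk (x ∷ ys) → IsWalk (xs ++ x ∷ ys)
    isWalk-++⁺ []           x ys _        w₂ = w₂
    isWalk-++⁺ (a ∷ [])     x ys (e , _)  w₂ = e , w₂
    isWalk-++⁺ (a ∷ b ∷ xs) x ys (e , w₁) w₂ = e , isWalk-++⁺ (b ∷ xs) x ys w₁ w₂

    closed-++ : ∀ a xs w ws → closed ((a ∷ xs) ++ (w ∷ ws)) ≡ (a ∷ xs) ++ w ∷ (ws ++ [ a ])
    closed-++ a xs w ws = cong (a ∷_) (List.++-assoc xs (w ∷ ws) [ a ])

    isWalk-rotate : ∀ xs ys → IsWalk (closed (xs ++ ys)) → IsWalk (closed (ys ++ xs))
    isWalk-rotate []       ys w rewrite List.++-identityʳ ys = w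
    isWalk-rotate (a ∷ xs) [] w rewrite List.++-identityʳ xs = w
    isWalk-rotate (a ∷ xs) (b ∷ ys) w with isWalk-++⁻ (a ∷ xs) b (ys ++ [ a ]) (subst IsWalk (closed-++ a xs b ys) w)
    ... | w₁ , w₂ = subst IsWalk (sym (closed-++ b ys a xs)) (isWalk-++⁺ (b ∷ ys) a (xs ++ [ b ]) w₂ w₁)

    walkSign-rotate : ∀ xs ys → walkSign (closed (xs ++ ys)) ≡ walkSign (closed (ys ++ xs))
    walkSign-rotate []       ys rewrite List.++-identityʳ ys = refl
    walkSign-rotate (a ∷ xs) [] rewrite List.++-identityʳ xs = refl
    walkSign-rotate (a ∷ xs) (b ∷ ys) =
      trans (cong walkSign (closed-++ a xs b ys))
      (trans (walkSign-++ (a ∷ xs) b (ys ++ [ a ]))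
      (trans (Sign.*-comm (walkSign ((a ∷ xs) ++ [ b ])) _)
      (trans (sym (walkSign-++ (b ∷ ys) a (xs ++ [ b ]))) (cong walkSign (sym (closed-++ b ys a xs))))))

    closed-split : ∀ d xs ys → closed (d ∷ xs ++ d ∷ ys) ≡ (d ∷ xs) ++ d ∷ (ys ++ [ d ])
    closed-split d xs ys = cong (d ∷_) (List.++-assoc xs (d ∷ ys) [ d ])

    isWalk-split : ∀ d xs ys → IsWalk (closed (d ∷ xs ++ d ∷ ys)) → IsWalk (closed (d ∷ xs)) × IsWalk (closed (d ∷ ys))
    isWalk-split d xs ys w = isWalk-++⁻ (d ∷ xs) d (ys ++ [ d ]) (subst IsWalk (closed-split d xs ys) w)

    walkSign-split : ∀ d xs ys → walkSign (closed (d ∷ xs ++ d ∷ ys)) ≡ walkSign (closed (d ∷ xs)) Sign.* walkSign (closed (d ∷ ys))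
    walkSign-split d xs ys = trans (cong walkSign (closed-split d xs ys)) (walkSign-++ (d ∷ xs) d (ys ++ [ d ]))

    unique-or-repeat : ∀ (xs : List (Fin n)) →
      Unique xs ⊎ ∃ λ ws → ∃ λ d → ∃ λ ys → ∃ λ zs → xs ≡ ws ++ d ∷ ys ++ d ∷ zs
    unique-or-repeat [] = inj₁ []
    unique-or-repeat (x ∷ xs) with x ∈? xs
      where open import Data.List.Membership.DecPropositional (_≟_ {n}) using (_∈?_)
    ... | yes x∈xs = let ys , zs , eq = ∈-∃++ x∈xs in inj₂ ([] , x , ys , zs , cong (x ∷_) eq)
    ... | no  x∉xs with unique-or-repeat xs
    ...   | inj₁ u = inj₁ (¬Any⇒All¬ xs x∉xs ∷ u)
    ...   | inj₂ (ws , d , ys , zs , eq) = inj₂ (x ∷ ws , d , ys , zs , cong (x ∷_) eq)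

    lookup-injective : ∀ (xs : List (Fin n)) → Unique xs → ∀ {i j} → List.lookup xs i ≡ List.lookup xs j → i ≡ j
    lookup-injective (x ∷ xs) (x∉ ∷ u) {zero}  {zero}  _  = refl
    lookup-injective (x ∷ xs) (x∉ ∷ u) {zero}  {suc j} eq = ⊥-elim (All.lookup x∉ (∈-lookup j) eq)
    lookup-injective (x ∷ xs) (x∉ ∷ u) {suc i} {zero}  eq = ⊥-elim (All.lookup x∉ (∈-lookup i) (sym eq))
    lookup-injective (x ∷ xs) (x∉ ∷ u) {suc i} {suc j} eq = cong suc (lookup-injective xs u eq)

    isWalk⇒edges : ∀ z zs → IsWalk (z ∷ zs) → ∀ (i : Fin (length zs)) →
      IsEdge (edge G (List.lookup (z ∷ zs) (inject₁ i)) (List.lookup (z ∷ zs) (suc i)))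
    isWalk⇒edges z (z′ ∷ zs) (e , w) zero    = e
    isWalk⇒edges z (z′ ∷ zs) (e , w) (suc i) = isWalk⇒edges z′ zs w i

    isWalk⇒last-edge : ∀ z zs y → IsWalk ((z ∷ zs) ++ [ y ]) →
      IsEdge (edge G (List.lookup (z ∷ zs) (fromℕ (length zs))) y)
    isWalk⇒last-edge z []        y (e , _) = e
    isWalk⇒last-edge z (z′ ∷ zs) y (e , w) = isWalk⇒last-edge z′ zs y w

    isWalk-init : ∀ zs y → IsWalk (zs ++ [ y ]) → IsWalk zs
    isWalk-init []            y _       = tt
    isWalk-init (z ∷ [])      y _       = tt
    isWalk-init (z ∷ z′ ∷ zs) y (e , w) = e , isWalk-init (z′ ∷ zs) y w

    parity-negEdges : ∀ z zs y →
      parity (sum (List.tabulate (λ i → isNeg (edge G (List.lookup (z ∷ zs) (inject₁ i)) (List.lookup (z ∷ zs) (suc i)))))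
              ℕ.+ isNeg (edge G (List.lookup (z ∷ zs) (fromℕ (length zs))) y))
      ≡ walkSign ((z ∷ zs) ++ [ y ])
    parity-negEdges z []        y = trans (parity-isNeg (edge G z y)) (sym (Sign.*-identityʳ (signOf (edge G z y))))
    parity-negEdges z (z′ ∷ zs) y =
      trans (cong parity (ℕ.+-assoc (isNeg (edge G z z′)) _ _))
      (trans (parity-+ (isNeg (edge G z z′)) _)
      (cong₂ Sign._*_ (parity-isNeg (edge G z z′)) (parity-negEdges z′ zs y)))

    cycle-positive : Balanced G → ∀ y₀ y₁ y₂ ys → Unique (y₀ ∷ y₁ ∷ y₂ ∷ ys) →
      IsWalk (closed (y₀ ∷ y₁ ∷ y₂ ∷ ys)) → walkSign (closed (y₀ ∷ y₁ ∷ y₂ ∷ ys)) ≡ Sign.+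
    cycle-positive balanced y₀ y₁ y₂ ys u w = begin
      walkSign (closed (y₀ ∷ zs))                              ≡⟨ parity-negEdges y₀ zs y₀ ⟨
      parity (sum (List.tabulate f) ℕ.+ isNeg (edge G (c last) y₀))
        ≡⟨ cong (λ s → parity (sum s ℕ.+ isNeg (edge G (c last) y₀))) (List.map-tabulate id f) ⟨
      parity (negEdges G c)                                    ≡⟨ parity-even (negEdges G c) (balanced (length ys) c is-cycle) ⟩
      Sign.+                                                   ∎
      where
      open ≡-Reasoning
      zs : List (Fin n)
      zs = y₁ ∷ y₂ ∷ ys
      c : Fin (length (y₀ ∷ zs)) → Fin n
      c = List.lookup (y₀ ∷ zs)
      last : Fin (length (y₀ ∷ zs))
      last = fromℕ (length zs)
      f : Fin (length zs) → ℕ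
      f i = isNeg (edge G (c (inject₁ i)) (c (suc i)))
      is-cycle : IsCycle G c
      is-cycle = lookup-injective (y₀ ∷ zs) u , isWalk⇒edges y₀ zs (isWalk-init (y₀ ∷ zs) y₀ w) , isWalk⇒last-edge y₀ zs y₀ w

    balanced⇒closedWalksPositive : Balanced G → ClosedWalksPositive
    balanced⇒closedWalksPositive balanced ys = go (suc (length ys)) ys ℕ.≤-refl
      where
      go : ∀ k ys → length ys < k → IsWalk (closed ys) → walkSign (closed ys) ≡ Sign.+
      go (suc k) []       _ _ = refl
      go (suc k) (y ∷ ys) _ w with unique-or-repeat (y ∷ ys)
      go (suc k) (y ∷ [])             _ (e , _) | inj₁ _ = ⊥-elim (e (noLoop G y))
      go (suc k) (y ∷ z ∷ [])         _ _       | inj₁ _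
        rewrite symm G z y | Sign.*-identityʳ (signOf (edge G y z)) = Sign.s*s≡+ (signOf (edge G y z))
      go (suc k) (y₀ ∷ y₁ ∷ y₂ ∷ ys) _ w       | inj₁ u = cycle-positive balanced y₀ y₁ y₂ ys u w
      go (suc k) (y ∷ ys) |ys|<k w | inj₂ (a , d , b , c , eq) = begin
        walkSign (closed (y ∷ ys))                                      ≡⟨ cong (walkSign ∘ closed) eq ⟩
        walkSign (closed (a ++ d ∷ b ++ d ∷ c))                         ≡⟨ walkSign-rotate a (d ∷ b ++ d ∷ c) ⟩
        walkSign (closed ((d ∷ b ++ d ∷ c) ++ a))                       ≡⟨ cong (walkSign ∘ closed) reassociate ⟩
        walkSign (closed (d ∷ b ++ d ∷ (c ++ a)))                       ≡⟨ walkSign-split d b (c ++ a) ⟩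
        walkSign (closed (d ∷ b)) Sign.* walkSign (closed (d ∷ c ++ a)) ≡⟨ cong₂ Sign._*_ (go k (d ∷ b) shorter₁ (proj₁ walks))
                                                                                            (go k (d ∷ c ++ a) shorter₂ (proj₂ walks)) ⟩
        Sign.+                                                          ∎
        where
        open ≡-Reasoning
        reassociate : (d ∷ b ++ d ∷ c) ++ a ≡ d ∷ b ++ d ∷ (c ++ a)
        reassociate = cong (d ∷_) (List.++-assoc b (d ∷ c) a)
        walks : IsWalk (closed (d ∷ b)) × IsWalk (closed (d ∷ c ++ a))
        walks = isWalk-split d b (c ++ a)
          (subst (IsWalk ∘ closed) reassociate (isWalk-rotate a (d ∷ b ++ d ∷ c) (subst (IsWalk ∘ closed) eq w)))
        length-split : length (y ∷ ys) ≡ length (d ∷ b) ℕ.+ length (d ∷ c ++ a)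
        length-split = begin
          length (y ∷ ys)                    ≡⟨ cong length eq ⟩
          length (a ++ d ∷ b ++ d ∷ c)       ≡⟨ List.length-++-comm a (d ∷ b ++ d ∷ c) ⟩
          length ((d ∷ b ++ d ∷ c) ++ a)     ≡⟨ cong length reassociate ⟩
          length ((d ∷ b) ++ d ∷ (c ++ a))   ≡⟨ List.length-++ (d ∷ b) ⟩
          length (d ∷ b) ℕ.+ length (d ∷ c ++ a) ∎
        ≤k : length (d ∷ b) ℕ.+ length (d ∷ c ++ a) ≤ k
        ≤k = subst (_≤ k) length-split (ℕ.≤-pred |ys|<k)
        shorter₁ : length (d ∷ b) < k
        shorter₁ = ℕ.<-≤-trans (ℕ.m<m+n (length (d ∷ b)) (s≤s ℕ.z≤n)) ≤k
        shorter₂ : length (d ∷ c ++ a) < k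
        shorter₂ = ℕ.<-≤-trans (ℕ.m<n+m (length (d ∷ c ++ a)) (s≤s ℕ.z≤n)) ≤k

module Switching where

  open import Data.Nat using (ℕ; zero; suc)
  open import Data.Fin using (Fin; zero; suc)
  open import Data.Fin.Properties using (_≟_)
  open import Data.Maybe using (Maybe; just; nothing)
  open import Data.Sign as Sign using (Sign)
  import Data.Sign.Properties as Sign
  open import Data.Bool using (Bool; true; false)
  open import Data.List as List using (List; []; _∷_; _++_; [_])
  import Data.List.Properties as List
  open import Data.Product using (∃; _×_; _,_)
  open import Data.Sum using (_⊎_; inj₁; inj₂)
  open import Data.Unit using (tt)
  open import Data.Empty using (⊥-elim)
  open import Function using (_∘_)
  open import Relation.Binary.PropositionalEquality hiding ([_])
  open import Relation.Nullary using (yes; no; does)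
  open import Relation.Nullary.Decidable using (dec-true; dec-false)
  open import Defs
  open Balance

  IsSwitching : ∀ {n} → SignedGraph n → (Fin n → Sign) → Set
  IsSwitching G τ = ∀ i j s → edge G i j ≡ just s → s ≡ τ i Sign.* τ j

  just⇒IsEdge : ∀ {s : Sign} {e} → e ≡ just s → IsEdge e
  just⇒IsEdge refl ()

  -- An existing edge is kept, and two distinct neighbours of the deleted vertex, joined to it
  -- with signs a and b, get an edge of sign a b (the Bool says whether the two coincide).
  bypassEdge : Maybe Sign → Maybe Sign → Maybe Sign → Bool → Maybe Sign
  bypassEdge (just s) _        _        _     = just s
  bypassEdge nothing  (just a) (just b) false = just (a Sign.* b)
  bypassEdge nothing  _        _        _     = nothing

  bypassEdge-sym : ∀ e x y b → bypassEdge e x y b ≡ bypassEdge e y x b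
  bypassEdge-sym (just s) x        y        b     = refl
  bypassEdge-sym nothing  (just a) (just b) false = cong just (Sign.*-comm a b)
  bypassEdge-sym nothing  (just a) (just b) true  = refl
  bypassEdge-sym nothing  (just a) nothing  b     = refl
  bypassEdge-sym nothing  nothing  (just a) b     = refl
  bypassEdge-sym nothing  nothing  nothing  b     = refl

  does-≟-sym : ∀ {n} (i j : Fin n) → does (i ≟ j) ≡ does (j ≟ i)
  does-≟-sym i j with i ≟ j
  ... | yes refl = sym (dec-true (i ≟ i) refl)
  ... | no  i≢j  = sym (dec-false (j ≟ i) (i≢j ∘ sym))

  neighbour? : ∀ {n} (f : Fin n → Maybe Sign) → (∃ λ u → ∃ λ a → f u ≡ just a) ⊎ (∀ u → f u ≡ nothing)
  neighbour? {zero}  f = inj₂ (λ ())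
  neighbour? {suc n} f with f zero in eq
  ... | just a  = inj₁ (zero , a , eq)
  ... | nothing with neighbour? (f ∘ suc)
  ...   | inj₁ (u , a , e) = inj₁ (suc u , a , e)
  ...   | inj₂ none        = inj₂ (λ { zero → eq ; (suc u) → none u })

  module Bypass {n : ℕ} (G : SignedGraph (suc n)) (positive : ClosedWalksPositive G) where

    toZero : Fin n → Maybe Sign
    toZero i = edge G zero (suc i)

    bypass : SignedGraph n
    bypass = record
      { edge   = λ i j → bypassEdge (edge G (suc i) (suc j)) (toZero i) (toZero j) (does (i ≟ j))
      ; symm   = λ i j → trans (cong (λ e → bypassEdge e (toZero i) (toZero j) (does (i ≟ j))) (symm G (suc i) (suc j)))
                         (trans (bypassEdge-sym _ (toZero i) (toZero j) _)
                                (cong (bypassEdge (edge G (suc j) (suc i)) (toZero j) (toZero i)) (does-≟-sym i j)))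
      ; noLoop = λ i → trans (cong₂ (λ e b → bypassEdge e (toZero i) (toZero i) b) (noLoop G (suc i)) (dec-true (i ≟ i) refl))
                             (no-loop (toZero i))
      }
      where
      no-loop : ∀ x → bypassEdge nothing x x true ≡ nothing
      no-loop (just _) = refl
      no-loop nothing  = refl

    detour : Maybe Sign → List (Fin (suc n))
    detour (just _) = []
    detour nothing  = zero ∷ []

    expand : List (Fin n) → List (Fin (suc n))
    expand []            = []
    expand (x ∷ [])      = suc x ∷ []
    expand (x ∷ y ∷ ys) = suc x ∷ (detour (edge G (suc x) (suc y)) ++ expand (y ∷ ys))

    expand-∷ : ∀ y ys → ∃ λ zs → expand (y ∷ ys) ≡ suc y ∷ zs
    expand-∷ y []      = [] , refl
    expand-∷ y (z ∷ r) = _ , refl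

    expand-closed : ∀ x ys y → ∃ λ zs → expand (x ∷ ys ++ [ y ]) ≡ suc x ∷ zs ++ [ suc y ]
    expand-closed x []       y = detour (edge G (suc x) (suc y)) , refl
    expand-closed x (z ∷ ys) y with expand-closed z ys y
    ... | zs , eq = detour (edge G (suc x) (suc z)) ++ suc z ∷ zs ,
      cong (suc x ∷_) (trans (cong (detour (edge G (suc x) (suc z)) ++_) eq)
                             (sym (List.++-assoc (detour (edge G (suc x) (suc z))) (suc z ∷ zs) [ suc y ])))

    toZero-sym : ∀ x → edge G (suc x) zero ≡ toZero x
    toZero-sym x = symm G (suc x) zero

    expand-edge : ∀ x y zs → IsWalk G (suc y ∷ zs) → IsEdge (edge bypass x y) →
      let w = suc x ∷ detour (edge G (suc x) (suc y)) ++ suc y ∷ zs in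
      IsWalk G w × walkSign G w ≡ signOf (edge bypass x y) Sign.* walkSign G (suc y ∷ zs)
    expand-edge x y zs walk x~y with edge G (suc x) (suc y) in exy
    ... | just s  = (just⇒IsEdge exy , walk) , cong (λ e → signOf e Sign.* walkSign G (suc y ∷ zs)) exy
    ... | nothing with toZero x in ex | toZero y in ey | x ≟ y
    ...   | just a  | just b  | no _  =
      (just⇒IsEdge (trans (toZero-sym x) ex) , (λ ()) , walk) ,
      trans (cong (λ e → signOf e Sign.* (b Sign.* walkSign G (suc y ∷ zs))) (trans (toZero-sym x) ex))
            (sym (Sign.*-assoc a b _))
    ...   | just a  | just b  | yes _ = ⊥-elim (x~y refl)
    ...   | just a  | nothing | _     = ⊥-elim (x~y refl)
    ...   | nothing | _       | _     = ⊥-elim (x~y refl)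

    expand-walk : ∀ zs → IsWalk bypass zs → IsWalk G (expand zs) × walkSign G (expand zs) ≡ walkSign bypass zs
    expand-walk []            _       = tt , refl
    expand-walk (x ∷ [])      _       = tt , refl
    expand-walk (x ∷ y ∷ ys) (e , w) with expand-walk (y ∷ ys) w | expand-∷ y ys
    ... | walk , sign | zs , eq rewrite eq with expand-edge x y zs walk e
    ...   | walk′ , sign′ = walk′ , trans sign′ (cong (signOf (edge bypass x y) Sign.*_) sign)

    bypass-positive : ClosedWalksPositive bypass
    bypass-positive []       _ = refl
    bypass-positive (y ∷ ys) w with expand-closed y ys y | expand-walk (y ∷ ys ++ [ y ]) w
    ... | zs , eq | walk , sign =
      trans (sym sign) (trans (cong (walkSign G) eq) (positive (suc y ∷ zs) (subst (IsWalk G) eq walk)))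

    triangle-sign : ∀ u j {a b s} → toZero u ≡ just a → toZero j ≡ just b → edge G (suc u) (suc j) ≡ just s →
      s ≡ a Sign.* b
    triangle-sign u j {a} {b} {s} eu ej es =
      solve a s b (trans (sym sign) (positive (zero ∷ suc u ∷ suc j ∷ []) walk))
      where
      ej′ : edge G (suc j) zero ≡ just b
      ej′ = trans (toZero-sym j) ej
      walk : IsWalk G (closed G (zero ∷ suc u ∷ suc j ∷ []))
      walk = just⇒IsEdge eu , just⇒IsEdge es , just⇒IsEdge ej′ , tt
      sign : walkSign G (closed G (zero ∷ suc u ∷ suc j ∷ [])) ≡ a Sign.* (s Sign.* (b Sign.* Sign.+))
      sign = cong₂ Sign._*_ (cong signOf eu) (cong₂ Sign._*_ (cong signOf es) (cong (Sign._* Sign.+) (cong signOf ej′)))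
      solve : ∀ a s b → a Sign.* (s Sign.* (b Sign.* Sign.+)) ≡ Sign.+ → s ≡ a Sign.* b
      solve Sign.+ Sign.+ Sign.+ _ = refl
      solve Sign.+ Sign.- Sign.- _ = refl
      solve Sign.- Sign.+ Sign.- _ = refl
      solve Sign.- Sign.- Sign.+ _ = refl
      solve Sign.+ Sign.+ Sign.- ()
      solve Sign.+ Sign.- Sign.+ ()
      solve Sign.- Sign.+ Sign.+ ()
      solve Sign.- Sign.- Sign.- ()

    bypass-neighbours : ∀ u j {a b} → u ≢ j → toZero u ≡ just a → toZero j ≡ just b →
      edge bypass u j ≡ just (a Sign.* b)
    bypass-neighbours u j u≢j eu ej with edge G (suc u) (suc j) in es
    ... | just s  = cong just (triangle-sign u j eu ej es)
    ... | nothing rewrite eu | ej | dec-false (u ≟ j) u≢j = refl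

  -- A switching of the bypass graph extends to vertex 0: its edges all demand the same sign
  -- for it, because every triangle through 0 is positive.
  closedWalksPositive⇒switching : ∀ n (G : SignedGraph n) → ClosedWalksPositive G → ∃ (IsSwitching G)
  closedWalksPositive⇒switching zero    G _        = (λ ()) , (λ ())
  closedWalksPositive⇒switching (suc n) G positive
    with closedWalksPositive⇒switching n (Bypass.bypass G positive) (Bypass.bypass-positive G positive)
  ... | τ′ , switching′ = τ , switching
    where
    open Bypass G positive
    τ₀ : Sign
    τ₀ with neighbour? toZero
    ... | inj₁ (u , a , _) = a Sign.* τ′ u
    ... | inj₂ _           = Sign.+
    τ : Fin (suc n) → Sign
    τ zero    = τ₀
    τ (suc i) = τ′ i
    from-zero : ∀ j s → edge G zero (suc j) ≡ just s → s ≡ τ₀ Sign.* τ′ j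
    from-zero j s e with neighbour? toZero
    ... | inj₂ none = ⊥-elim (just⇒IsEdge e (none j))
    ... | inj₁ (u , a , eu) with u ≟ j
    ...   | yes refl with trans (sym eu) e
    ...     | refl = sym (trans (Sign.*-assoc s (τ′ u) (τ′ u)) (trans (cong (s Sign.*_) (Sign.s*s≡+ (τ′ u))) (Sign.*-identityʳ s)))
    from-zero j s e | inj₁ (u , a , eu) | no u≢j =
      shift a s (τ′ u) (τ′ j) (switching′ u j (a Sign.* s) (bypass-neighbours u j u≢j eu e))
      where
      shift : ∀ a s t r → a Sign.* s ≡ t Sign.* r → s ≡ (a Sign.* t) Sign.* r
      shift a s t r eq = begin
        s                      ≡⟨ trans (sym (Sign.*-assoc a a s)) (cong (Sign._* s) (Sign.s*s≡+ a)) ⟨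
        a Sign.* (a Sign.* s)  ≡⟨ cong (a Sign.*_) eq ⟩
        a Sign.* (t Sign.* r)  ≡⟨ Sign.*-assoc a t r ⟨
        (a Sign.* t) Sign.* r  ∎
        where open ≡-Reasoning
    switching : IsSwitching G τ
    switching zero    zero    s e = ⊥-elim (just⇒IsEdge e (noLoop G zero))
    switching zero    (suc j) s e = from-zero j s e
    switching (suc i) zero    s e = trans (from-zero i s (trans (sym (toZero-sym i)) e)) (Sign.*-comm τ₀ (τ′ i))
    switching (suc i) (suc j) s e = switching′ i j s (cong (λ e → bypassEdge e (toZero i) (toZero j) (does (i ≟ j))) e)

  balanced⇒switching : ∀ {n} (G : SignedGraph n) → Balanced G → ∃ (IsSwitching G)
  balanced⇒switching {n} G balanced = closedWalksPositive⇒switching n G (balanced⇒closedWalksPositive G balanced)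

module ListColouring where

  open import Data.Nat as ℕ using (ℕ; zero; suc)
  import Data.Nat.Properties as ℕ
  open import Data.Integer using (ℤ; +_; -_; _≟_)
  open import Data.Integer.Properties using (neg-involutive; neg-injective; +-injective)
  open import Data.Fin using (Fin; zero; suc)
  open import Data.Bool using (Bool; true; false; not; _∧_)
  open import Data.Bool.ListAction using (all; and)
  open import Data.Maybe using (Maybe; just; nothing)
  open import Data.Sign as Sign using (Sign)
  open import Data.List as List using (List; []; _∷_; _++_; length; map; allFin)
  import Data.List.Properties as List
  open import Data.List.Membership.Propositional using (_∈_; _∉_)
  open import Data.List.Membership.Propositional.Properties using (∈-++⁻; ∈-++⁺ˡ; ∈-++⁺ʳ; ∈-map⁻; ∈-applyUpTo⁻)
  open import Data.List.Relation.Unary.Any using (here; there)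
  open import Data.List.Relation.Unary.All as All using (All; []; _∷_)
  open import Data.List.Relation.Unary.AllPairs using ([]; _∷_)
  open import Data.List.Relation.Unary.Unique.Propositional using (Unique)
  import Data.List.Relation.Unary.Unique.Propositional.Properties as Unique
  open import Data.List.Relation.Binary.Permutation.Propositional using (_↭_; ↭-trans)
  import Data.List.Relation.Binary.Permutation.Propositional.Properties as ↭
  open import Data.Vec using (Vec; lookup; tabulate)
  open import Data.Vec.Properties using (lookup∘tabulate; lookup-replicate)
  open import Data.Fin.Subset using (Subset; ⊤)
  open import Data.Product using (∃; _×_; _,_; proj₁; proj₂)
  open import Data.Sum using (_⊎_; inj₁; inj₂)
  open import Data.Empty using (⊥; ⊥-elim)
  open import Function using (_∘_)
  open import Relation.Binary.PropositionalEquality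
  open import Relation.Nullary using (yes; no)
  open import Relation.Nullary.Decidable using (⌊_⌋)
  open import Defs
  open Counting
  open ColourSets
  open Switching using (IsSwitching)

  applySign-* : ∀ s t x → applySign (s Sign.* t) x ≡ applySign s (applySign t x)
  applySign-* Sign.+ t      x = refl
  applySign-* Sign.- Sign.+ x = refl
  applySign-* Sign.- Sign.- x = sym (neg-involutive x)

  applySign-involutive : ∀ s x → applySign s (applySign s x) ≡ x
  applySign-involutive Sign.+ x = refl
  applySign-involutive Sign.- x = neg-involutive x

  all-cong : ∀ {A : Set} {p q : A → Bool} → (∀ x → p x ≡ q x) → ∀ xs → all p xs ≡ all q xs
  all-cong p≗q xs = cong and (List.map-cong p≗q xs)

  ⌊≟⌋-cong : ∀ {a b c d : ℤ} → (a ≡ b → c ≡ d) → (c ≡ d → a ≡ b) → ⌊ a ≟ b ⌋ ≡ ⌊ c ≟ d ⌋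
  ⌊≟⌋-cong {a} {b} {c} {d} to from with a ≟ b | c ≟ d
  ... | yes a≡b | yes _   = refl
  ... | yes a≡b | no c≢d  = ⊥-elim (c≢d (to a≡b))
  ... | no a≢b  | yes c≡d = ⊥-elim (a≢b (from c≡d))
  ... | no _    | no _    = refl

  separated : Bool → Maybe Sign → ℤ → ℤ → Bool
  separated false _        _ _ = true
  separated true  nothing  _ _ = true
  separated true  (just _) x y = not ⌊ x ≟ y ⌋

  separated-cong : ∀ {b b′ e x x′ y y′} → b ≡ b′ → x ≡ x′ → y ≡ y′ → separated b e x y ≡ separated b′ e x′ y′
  separated-cong refl refl refl = refl

  module _ {n : ℕ} (H : SignedGraph n) where

    properOn : Subset n → Vec ℤ n → Bool
    properOn β κ =
      all (λ i → all (λ j → separated (lookup β i ∧ lookup β j) (edge H i j) (lookup κ i) (lookup κ j)) (allFin n)) (allFin n)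

    module _ (τ : Fin n → Sign) (switching : IsSwitching H τ) where

      switch : Vec ℤ n → Vec ℤ n
      switch κ = tabulate (λ i → applySign (τ i) (lookup κ i))

      edgeOK-switch : ∀ i j a b → edgeOK (edge H i j) a b ≡ separated true (edge H i j) (applySign (τ i) a) (applySign (τ j) b)
      edgeOK-switch i j a b with edge H i j in eq
      ... | nothing = refl
      ... | just s  = cong not (⌊≟⌋-cong to from)
        where
        s≡ : s ≡ τ i Sign.* τ j
        s≡ = switching i j s eq
        τb : applySign s b ≡ applySign (τ i) (applySign (τ j) b)
        τb = trans (cong (λ t → applySign t b) s≡) (applySign-* (τ i) (τ j) b)
        to : a ≡ applySign s b → applySign (τ i) a ≡ applySign (τ j) b
        to a≡ = trans (cong (applySign (τ i)) (trans a≡ τb)) (applySign-involutive (τ i) _)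
        from : applySign (τ i) a ≡ applySign (τ j) b → a ≡ applySign s b
        from eq′ = trans (sym (applySign-involutive (τ i) a)) (trans (cong (applySign (τ i)) eq′) (sym τb))

      isProper-switch : ∀ κ → isProper H κ ≡ properOn ⊤ (switch κ)
      isProper-switch κ = all-cong (λ i → all-cong (λ j →
        trans (edgeOK-switch i j (lookup κ i) (lookup κ j))
              (sym (separated-cong (cong₂ _∧_ (lookup-replicate i true) (lookup-replicate j true))
                                   (lookup∘tabulate _ i) (lookup∘tabulate _ j)))) (allFin n)) (allFin n)

      count-switch : ∀ C → count n (λ _ → C) (isProper H) ≡ count n (λ i → map (applySign (τ i)) C) (properOn ⊤)
      count-switch C = trans (count-cong n (λ _ → C) (λ κ _ → isProper-switch κ))
                             (sym (count-map n (λ i → applySign (τ i)) (λ _ → C) (properOn ⊤)))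

  relabel : List ℤ → List ℤ → ℤ → ℤ
  relabel []       _        x = x
  relabel (a ∷ as) []       x = x
  relabel (a ∷ as) (b ∷ bs) x with x ≟ a
  ... | yes _ = b
  ... | no  _ = relabel as bs x

  relabel-here : ∀ a as b bs → relabel (a ∷ as) (b ∷ bs) a ≡ b
  relabel-here a as b bs with a ≟ a
  ... | yes _   = refl
  ... | no  a≢a = ⊥-elim (a≢a refl)

  relabel-there : ∀ {a as b bs x} → x ≢ a → relabel (a ∷ as) (b ∷ bs) x ≡ relabel as bs x
  relabel-there {a} {x = x} x≢a with x ≟ a
  ... | yes x≡a = ⊥-elim (x≢a x≡a)
  ... | no  _   = refl

  ∈-relabel : ∀ X Y {x} → length X ≡ length Y → x ∈ X → relabel X Y x ∈ Y
  ∈-relabel (a ∷ as) (b ∷ bs) |X|≡|Y| (here refl) = subst (_∈ b ∷ bs) (sym (relabel-here a as b bs)) (here refl)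
  ∈-relabel (a ∷ as) (b ∷ bs) {x} |X|≡|Y| (there x∈as) with x ≟ a
  ... | yes _ = here refl
  ... | no  _ = there (∈-relabel as bs (ℕ.suc-injective |X|≡|Y|) x∈as)

  map-cong-∈ : ∀ xs {f g : ℤ → ℤ} → (∀ {x} → x ∈ xs → f x ≡ g x) → map f xs ≡ map g xs
  map-cong-∈ []       f≗g = refl
  map-cong-∈ (x ∷ xs) f≗g = cong₂ _∷_ (f≗g (here refl)) (map-cong-∈ xs (f≗g ∘ there))

  map-relabel : ∀ X Y → Unique X → length X ≡ length Y → map (relabel X Y) X ≡ Y
  map-relabel []       []       _          _       = refl
  map-relabel (a ∷ as) (b ∷ bs) (a∉as ∷ u) |X|≡|Y| =
    cong₂ _∷_ (relabel-here a as b bs)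
      (trans (map-cong-∈ as (λ x∈as → relabel-there (λ x≡a → All.lookup a∉as x∈as (sym x≡a))))
             (map-relabel as bs u (ℕ.suc-injective |X|≡|Y|)))

  relabel-inverse : ∀ X Y {x} → Unique X → Unique Y → length X ≡ length Y → x ∈ X → relabel Y X (relabel X Y x) ≡ x
  relabel-inverse (a ∷ as) (b ∷ bs) _ _ _ (here refl)
    rewrite relabel-here a as b bs = relabel-here b bs a as
  relabel-inverse (a ∷ as) (b ∷ bs) {x} (a∉as ∷ uX) (b∉bs ∷ uY) |X|≡|Y| (there x∈as) =
    begin
      relabel (b ∷ bs) (a ∷ as) (relabel (a ∷ as) (b ∷ bs) x) ≡⟨ cong (relabel (b ∷ bs) (a ∷ as)) (relabel-there x≢a) ⟩
      relabel (b ∷ bs) (a ∷ as) (relabel as bs x)             ≡⟨ relabel-there y≢b ⟩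
      relabel bs as (relabel as bs x)                         ≡⟨ relabel-inverse as bs uX uY |as|≡|bs| x∈as ⟩
      x                                                       ∎
    where
    open ≡-Reasoning
    |as|≡|bs| = ℕ.suc-injective |X|≡|Y|
    x≢a : x ≢ a
    x≢a x≡a = All.lookup a∉as x∈as (sym x≡a)
    y≢b : relabel as bs x ≢ b
    y≢b y≡b = All.lookup b∉bs (∈-relabel as bs |as|≡|bs| x∈as) (sym y≡b)

  relabel-injective : ∀ X Y {x y} → Unique X → Unique Y → length X ≡ length Y → x ∈ X → y ∈ X →
    relabel X Y x ≡ relabel X Y y → x ≡ y
  relabel-injective X Y uX uY |X|≡|Y| x∈X y∈X eq =
    trans (sym (relabel-inverse X Y uX uY |X|≡|Y| x∈X)) (trans (cong (relabel Y X) eq) (relabel-inverse X Y uX uY |X|≡|Y| y∈X))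

  ++-injective : ∀ {xs xs′ ys ys′ : List ℤ} → length xs ≡ length xs′ → xs ++ ys ≡ xs′ ++ ys′ → xs ≡ xs′ × ys ≡ ys′
  ++-injective {[]}     {[]}       _       eq = refl , eq
  ++-injective {x ∷ xs} {x′ ∷ xs′} |xs|≡ eq with ++-injective (ℕ.suc-injective |xs|≡) (List.∷-injectiveʳ eq)
  ... | xs≡ , ys≡ = cong₂ _∷_ (List.∷-injectiveˡ eq) xs≡ , ys≡

  separated-injective : ∀ (π : ℤ → ℤ) b e x y → (π x ≡ π y → x ≡ y) → separated b e (π x) (π y) ≡ separated b e x y
  separated-injective π false e        x y _   = refl
  separated-injective π true  nothing  x y _   = refl
  separated-injective π true  (just s) x y inj = cong not (⌊≟⌋-cong inj (cong π))

  signedCopy : Sign → List ℤ → List ℤ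
  signedCopy Sign.+ S = S
  signedCopy Sign.- S = map -_ S

  module _ {n : ℕ} (H : SignedGraph n) (τ : Fin n → Sign) where

    colouringsWith : List ℤ → List ℤ → ℕ
    colouringsWith F S = count n (λ i → F ++ signedCopy (τ i) S) (properOn H ⊤)

    properOn-injective : ∀ β (π : ℤ → ℤ) X → (∀ {x y} → x ∈ X → y ∈ X → π x ≡ π y → x ≡ y) →
      ∀ κ → (∀ i → lookup κ i ∈ X) → properOn H β (tabulate (π ∘ lookup κ)) ≡ properOn H β κ
    properOn-injective β π X inj κ κ∈X = all-cong (λ i → all-cong (λ j →
      trans (cong₂ (separated (lookup β i ∧ lookup β j) (edge H i j)) (lookup∘tabulate _ i) (lookup∘tabulate _ j))
            (separated-injective π (lookup β i ∧ lookup β j) (edge H i j) _ _ (inj (κ∈X i) (κ∈X j)))) (allFin n)) (allFin n)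

    colouringsWith-relabel : ∀ F S F′ S′ → Unique (F ++ S ++ map -_ S) → Unique (F′ ++ S′ ++ map -_ S′) →
      length F ≡ length F′ → length S ≡ length S′ → colouringsWith F S ≡ colouringsWith F′ S′
    colouringsWith-relabel F S F′ S′ uX uY |F|≡ |S|≡ =
      trans (count-cong n lists (λ κ κ∈ → sym (properOn-injective ⊤ π X
                                                (relabel-injective X Y uX uY |X|≡|Y|) κ (λ i → lists⊆X i (κ∈ i)))))
      (trans (sym (count-map n (λ _ → π) lists (properOn H ⊤)))
             (count-lists-cong n (properOn H ⊤) (λ i → map-lists (τ i))))
      where
      X Y : List ℤ
      X = F ++ S ++ map -_ S
      Y = F′ ++ S′ ++ map -_ S′
      lists : Fin n → List ℤ
      lists = λ i → F ++ signedCopy (τ i) S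
      |X|≡|Y| : length X ≡ length Y
      |X|≡|Y| rewrite List.length-++ F {S ++ map -_ S} | List.length-++ S {map -_ S} | List.length-map -_ S
                    | List.length-++ F′ {S′ ++ map -_ S′} | List.length-++ S′ {map -_ S′} | List.length-map -_ S′
                    | |F|≡ | |S|≡ = refl
      π : ℤ → ℤ
      π = relabel X Y
      split₁ : map π F ≡ F′ × map π (S ++ map -_ S) ≡ S′ ++ map -_ S′
      split₁ = ++-injective (trans (List.length-map π F) |F|≡) (trans (sym (List.map-++ π F _)) (map-relabel X Y uX |X|≡|Y|))
      split₂ : map π S ≡ S′ × map π (map -_ S) ≡ map -_ S′
      split₂ = ++-injective (trans (List.length-map π S) |S|≡) (trans (sym (List.map-++ π S _)) (proj₂ split₁))
      map-lists : ∀ t → map π (F ++ signedCopy t S) ≡ F′ ++ signedCopy t S′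
      map-lists Sign.+ = trans (List.map-++ π F S) (cong₂ _++_ (proj₁ split₁) (proj₁ split₂))
      map-lists Sign.- = trans (List.map-++ π F (map -_ S)) (cong₂ _++_ (proj₁ split₁) (proj₂ split₂))
      lists⊆X : ∀ i {x} → x ∈ F ++ signedCopy (τ i) S → x ∈ X
      lists⊆X i x∈ with τ i | ∈-++⁻ F x∈
      ... | _      | inj₁ x∈F  = ∈-++⁺ˡ x∈F
      ... | Sign.+ | inj₂ x∈S  = ∈-++⁺ʳ F (∈-++⁺ˡ x∈S)
      ... | Sign.- | inj₂ x∈-S = ∈-++⁺ʳ F (∈-++⁺ʳ S x∈-S)

  module _ {n : ℕ} (H : SignedGraph n) (τ : Fin n → Sign) (switching : IsSwitching H τ) where

    count≡colouringsWith : ∀ {C} (d : Decomposition C) → let open Decomposition d in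
      count n (λ _ → C) (isProper H) ≡ colouringsWith H τ (Z ++ P) U
    count≡colouringsWith {C} d =
      trans (count-switch H τ switching C)
      (trans (count-↭ n (properOn H ⊤) (λ i → switched (τ i)))
             (count-lists-cong n (properOn H ⊤) (λ i → sym (List.++-assoc Z P (signedCopy (τ i) U)))))
      where
      open Decomposition d
      -Z++P++U : map -_ (Z ++ P ++ U) ≡ Z ++ map -_ P ++ map -_ U
      -Z++P++U = trans (List.map-++ -_ Z (P ++ U)) (cong₂ _++_ Z-neg (List.map-++ -_ P U))
      switched : ∀ t → map (applySign t) C ↭ Z ++ P ++ signedCopy t U
      switched Sign.+ = subst (_↭ Z ++ P ++ U) (sym (List.map-id C)) C↭Z++P++U
      switched Sign.- = ↭-trans (↭.map⁺ -_ C↭Z++P++U)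
        (subst (_↭ Z ++ P ++ map -_ U) (sym -Z++P++U) (↭.++⁺ˡ Z (↭.++⁺ʳ (map -_ U) -P↭P)))

  freshColours : ℕ → ℕ → List ℤ
  freshColours m zero    = []
  freshColours m (suc a) = + suc (m ℕ.+ a) ∷ freshColours m a

  unpairedColours : ℕ → List ℤ
  unpairedColours m = List.applyUpTo (+_ ∘ suc) m

  ∈-freshColours⁻ : ∀ m a {x} → x ∈ freshColours m a → ∃ λ k → k ℕ.< a × x ≡ + suc (m ℕ.+ k)
  ∈-freshColours⁻ m (suc a) (here refl)  = a , ℕ.≤-refl , refl
  ∈-freshColours⁻ m (suc a) (there x∈Fc) =
    let k , k<a , x≡ = ∈-freshColours⁻ m a x∈Fc in k , ℕ.m≤n⇒m≤1+n k<a , x≡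

  length-freshColours : ∀ m a → length (freshColours m a) ≡ a
  length-freshColours m zero    = refl
  length-freshColours m (suc a) = cong suc (length-freshColours m a)

  fresh-∉ : ∀ m a t → + suc (m ℕ.+ a) ∉ freshColours m a ++ signedCopy t (unpairedColours m)
  fresh-∉ m a t x∈ with ∈-++⁻ (freshColours m a) x∈
  ... | inj₁ x∈Fc with ∈-freshColours⁻ m a x∈Fc
  ...   | k , k<a , x≡ = ℕ.<-irrefl (ℕ.+-cancelˡ-≡ m k a (ℕ.suc-injective (+-injective (sym x≡)))) k<a
  fresh-∉ m a Sign.+ x∈ | inj₂ x∈U with ∈-applyUpTo⁻ (+_ ∘ suc) x∈U
  ... | j , j<m , x≡ = ℕ.<-irrefl refl (ℕ.<-≤-trans j<m (subst (m ℕ.≤_) (ℕ.suc-injective (+-injective x≡)) (ℕ.m≤m+n m a)))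
  fresh-∉ m a Sign.- x∈ | inj₂ x∈-U with ∈-map⁻ -_ x∈-U
  ... | y , y∈U , x≡-y with ∈-applyUpTo⁻ (+_ ∘ suc) y∈U
  ...   | j , _ , refl with () ← x≡-y

  unique-canonical : ∀ m a → Unique (freshColours m a ++ unpairedColours m ++ map -_ (unpairedColours m))
  unique-canonical m a = Unique.++⁺ (unique-fresh a) (Unique.++⁺ unique-U (Unique.map⁺ neg-injective unique-U) U∩-U)
    λ (x∈Fc , x∈±U) → Fc∩±U x∈Fc (∈-++⁻ (unpairedColours m) x∈±U)
    where
    unique-fresh : ∀ a → Unique (freshColours m a)
    unique-fresh zero    = []
    unique-fresh (suc a) = All.tabulate (λ x∈Fc x≡ → let k , k<a , y≡ = ∈-freshColours⁻ m a x∈Fc in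
      ℕ.<-irrefl (ℕ.+-cancelˡ-≡ m k a (ℕ.suc-injective (+-injective (trans (sym y≡) (sym x≡))))) k<a) ∷ unique-fresh a
    unique-U : Unique (unpairedColours m)
    unique-U = Unique.applyUpTo⁺₁ (+_ ∘ suc) m (λ { i<j _ refl → ℕ.<-irrefl refl i<j })
    U-member : ∀ {x} → x ∈ unpairedColours m → ∃ λ j → j ℕ.< m × x ≡ + suc j
    U-member = ∈-applyUpTo⁻ (+_ ∘ suc)
    U∩-U : ∀ {x} → x ∈ unpairedColours m × x ∈ map -_ (unpairedColours m) → ⊥
    U∩-U (x∈U , x∈-U) with U-member x∈U | ∈-map⁻ -_ x∈-U
    ... | _ , _ , refl | y , y∈U , x≡-y with U-member y∈U
    ...   | _ , _ , refl with () ← x≡-y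
    Fc∩±U : ∀ {x} → x ∈ freshColours m a → x ∈ unpairedColours m ⊎ x ∈ map -_ (unpairedColours m) → ⊥
    Fc∩±U x∈Fc (inj₁ x∈U) with ∈-freshColours⁻ m a x∈Fc | U-member x∈U
    ... | k , _ , refl | j , j<m , x≡ =
      ℕ.<-irrefl refl (ℕ.<-≤-trans j<m (subst (m ℕ.≤_) (ℕ.suc-injective (+-injective x≡)) (ℕ.m≤m+n m k)))
    Fc∩±U x∈Fc (inj₂ x∈-U) with ∈-freshColours⁻ m a x∈Fc | ∈-map⁻ -_ x∈-U
    ... | _ , _ , refl | y , y∈U , x≡-y with U-member y∈U
    ...   | _ , _ , refl with () ← x≡-y

  colourings : ∀ {n} → SignedGraph n → (Fin n → Sign) → ℕ → ℕ → ℕ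
  colourings H τ m a = colouringsWith H τ (freshColours m a) (unpairedColours m)

  count≡colourings : ∀ {n} (H : SignedGraph n) τ → IsSwitching H τ → ∀ {C} (d : Decomposition C) →
    count n (λ _ → C) (isProper H) ≡ colourings H τ (Decomposition.unpaired d) (Decomposition.shared d)
  count≡colourings H τ switching d =
    trans (count≡colouringsWith H τ switching d)
          (colouringsWith-relabel H τ _ _ _ _ unique-Z++P++±U (unique-canonical unpaired shared)
            (sym (length-freshColours unpaired shared)) (sym (List.length-applyUpTo _ unpaired)))
    where open Decomposition d

module Polynomiality where

  open import Data.Nat as ℕ using (ℕ; zero; suc; _+_; _*_; _≤_; _<_)
  import Data.Nat.Properties as ℕ
  open import Data.Nat.Tactic.RingSolver using (solve-∀)
  import Data.Integer.Tactic.RingSolver as ℤ-Solver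
  open import Data.Integer as ℤ using (ℤ; +_; 0ℤ; _≟_)
  open import Data.Integer.Properties using (pos-+; pos-*)
  open import Data.Fin using (Fin; zero; suc)
  open import Data.Fin.Subset using (Subset; ⊥; ⊤; _─_; _∩_; ∣_∣; Nonempty; _⊆_)
  open import Data.Fin.Subset.Properties using (p∩q≢∅⇒∣p─q∣<∣p∣; ∣p∣≤n; ⊥⊆)
  open import Data.Bool using (Bool; true; false; not; _∧_; T; if_then_else_)
  open import Data.Bool.ListAction using (all)
  open import Data.Bool.Properties using (T-∧; T-≡)
  open import Data.Maybe using (just; nothing)
  open import Data.Sign using (Sign)
  open import Data.List as List using (List; []; _∷_; _++_; map; allFin)
  import Data.List.Properties as List
  open import Data.List.Membership.Propositional using (_∈_; _∉_)
  open import Data.List.Membership.Propositional.Properties using (∈-++⁻; ∈-map⁻; ∈-allFin)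
  open import Data.List.Relation.Unary.Any using (here; there)
  open import Data.List.Relation.Unary.All as All using ()
  open import Data.List.Relation.Unary.All.Properties using (all⁺; all⁻)
  open import Data.Vec using (Vec; []; _∷_; lookup; tabulate; replicate) renaming (here to here′; there to there′)
  open import Data.Vec.Properties using (lookup∘tabulate; lookup-replicate; []=⇒lookup; lookup⇒[]=)
  open import Data.Product using (_×_; _,_; proj₁; proj₂)
  open import Data.Sum using (inj₁; inj₂)
  open import Data.Empty using (⊥-elim)
  open import Function using (_∘_; Equivalence)
  open import Relation.Binary.PropositionalEquality
  open import Relation.Nullary using (¬_; yes; no)
  open import Defs using (SignedGraph; edge; IsEdge)
  open FiniteDifferences
  open Counting
  open ListColouring

  subsets nonemptySubsets : ∀ {n} → Subset n → List (Subset n)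
  subsets β = ⊥ ∷ nonemptySubsets β
  nonemptySubsets []          = []
  nonemptySubsets (true ∷ β)  = map (true ∷_) (subsets β) ++ map (false ∷_) (nonemptySubsets β)
  nonemptySubsets (false ∷ β) = map (false ∷_) (nonemptySubsets β)

  ∈-subsets⇒⊆ : ∀ {n} (β : Subset n) {I} → I ∈ subsets β → I ⊆ β
  ∈-nonemptySubsets⇒⊆ : ∀ {n} (β : Subset n) {I} → I ∈ nonemptySubsets β → I ⊆ β
  ∈-subsets⇒⊆ β (here refl) = ⊥⊆
  ∈-subsets⇒⊆ β (there I∈)  = ∈-nonemptySubsets⇒⊆ β I∈
  ∈-nonemptySubsets⇒⊆ (true ∷ β) I∈ with ∈-++⁻ (map (true ∷_) (subsets β)) I∈
  ... | inj₁ I∈₁ with ∈-map⁻ (true ∷_) I∈₁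
  ...   | I′ , I′∈ , refl = λ { here′ → here′ ; (there′ i∈) → there′ (∈-subsets⇒⊆ β I′∈ i∈) }
  ∈-nonemptySubsets⇒⊆ (true ∷ β) I∈ | inj₂ I∈₂ with ∈-map⁻ (false ∷_) I∈₂
  ...   | I′ , I′∈ , refl = λ { (there′ i∈) → there′ (∈-nonemptySubsets⇒⊆ β I′∈ i∈) }
  ∈-nonemptySubsets⇒⊆ (false ∷ β) I∈ with ∈-map⁻ (false ∷_) I∈
  ... | I′ , I′∈ , refl = λ { (there′ i∈) → there′ (∈-nonemptySubsets⇒⊆ β I′∈ i∈) }

  ∈-nonemptySubsets⇒meets : ∀ {n} (β : Subset n) {I} → I ∈ nonemptySubsets β → Nonempty (β ∩ I)
  ∈-nonemptySubsets⇒meets (true ∷ β) I∈ with ∈-++⁻ (map (true ∷_) (subsets β)) I∈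
  ... | inj₁ I∈₁ with ∈-map⁻ (true ∷_) I∈₁
  ...   | I′ , I′∈ , refl = zero , here′
  ∈-nonemptySubsets⇒meets (true ∷ β) I∈ | inj₂ I∈₂ with ∈-map⁻ (false ∷_) I∈₂
  ...   | I′ , I′∈ , refl = let i , i∈ = ∈-nonemptySubsets⇒meets β I′∈ in suc i , there′ i∈
  ∈-nonemptySubsets⇒meets (false ∷ β) I∈ with ∈-map⁻ (false ∷_) I∈
  ... | I′ , I′∈ , refl = let i , i∈ = ∈-nonemptySubsets⇒meets β I′∈ in suc i , there′ i∈

  restrict : ∀ {n} → Subset n → (Fin n → List ℤ) → (Fin n → ℤ) → Fin n → List ℤ
  restrict β R δ i = if lookup β i then R i else δ i ∷ []

  withColour : ∀ {n} → Subset n → ℤ → (Fin n → List ℤ) → Fin n → List ℤ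
  withColour I x L i = if lookup I i then x ∷ [] else L i

  count-new-colour : ∀ n β x R δ Q →
    count n (restrict β (λ i → x ∷ R i) δ) Q ≡ ∑[ I ∈ subsets β ] count n (withColour I x (restrict β R δ)) Q
  count-new-colour zero    []      x R δ Q = sym (ℕ.+-identityʳ _)
  count-new-colour (suc n) (b ∷ β) x R δ Q = split b
    where
    open ≡-Reasoning
    F : ℤ → ℕ
    F c = count n (restrict β (λ i → x ∷ R (suc i)) (δ ∘ suc)) (Q ∘ (c ∷_))
    G : Subset n → ℤ → ℕ
    G I c = count n (withColour I x (restrict β (R ∘ suc) (δ ∘ suc))) (Q ∘ (c ∷_))
    expand : ∀ c → F c ≡ ∑[ I ∈ subsets β ] G I c
    expand c = count-new-colour n β x (R ∘ suc) (δ ∘ suc) (Q ∘ (c ∷_))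
    split : ∀ b → count (suc n) (restrict (b ∷ β) (λ i → x ∷ R i) δ) Q ≡
                  ∑[ I ∈ subsets (b ∷ β) ] count (suc n) (withColour I x (restrict (b ∷ β) R δ)) Q
    split true = begin
      F x + ∑[ c ∈ R zero ] F c
        ≡⟨ cong₂ _+_ (expand x) (∑-cong (R zero) (λ c _ → expand c)) ⟩
      ∑[ I ∈ subsets β ] G I x + ∑[ c ∈ R zero ] ∑[ I ∈ subsets β ] G I c
        ≡⟨ cong₂ _+_ (∑-cong (subsets β) (λ I _ → sym (ℕ.+-identityʳ (G I x))))
                     (∑-swap (R zero) (subsets β) (λ c I → G I c)) ⟩
      ∑[ I ∈ subsets β ] T′ (true ∷ I) + (T′ ⊥ + ∑[ I ∈ nonemptySubsets β ] T′ (false ∷ I))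
        ≡⟨ left-comm (∑[ I ∈ subsets β ] T′ (true ∷ I)) (T′ ⊥) _ ⟩
      T′ ⊥ + (∑[ I ∈ subsets β ] T′ (true ∷ I) + ∑[ I ∈ nonemptySubsets β ] T′ (false ∷ I))
        ≡⟨ cong (λ s → T′ ⊥ + s) (sym (trans (∑-++ (map (true ∷_) (subsets β)) _ T′)
                                (cong₂ _+_ (∑-map (subsets β) (true ∷_) T′) (∑-map (nonemptySubsets β) (false ∷_) T′)))) ⟩
      ∑[ I ∈ subsets (true ∷ β) ] T′ I ∎
      where
      T′ : Subset (suc n) → ℕ
      T′ I = count (suc n) (withColour I x (restrict (true ∷ β) R δ)) Q
      left-comm : ∀ a b c → a + (b + c) ≡ b + (a + c)
      left-comm = solve-∀
    split false = begin
      F (δ zero) + 0                                     ≡⟨ cong (_+ 0) (expand (δ zero)) ⟩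
      (∑[ I ∈ subsets β ] G I (δ zero)) + 0              ≡⟨ ℕ.+-identityʳ _ ⟩
      ∑[ I ∈ subsets β ] G I (δ zero)                    ≡⟨ ∑-cong (subsets β) (λ I _ → sym (ℕ.+-identityʳ _)) ⟩
      ∑[ I ∈ subsets β ] T′ (false ∷ I)                  ≡⟨ sym (∑-map (subsets β) (false ∷_) T′) ⟩
      ∑[ I ∈ subsets (false ∷ β) ] T′ I ∎
      where
      T′ : Subset (suc n) → ℕ
      T′ I = count (suc n) (withColour I x (restrict (false ∷ β) R δ)) Q

  lookup-─ : ∀ {n} (β I : Subset n) i → lookup (β ─ I) i ≡ lookup β i ∧ not (lookup I i)
  lookup-─ (true  ∷ β) (true  ∷ I) zero    = refl
  lookup-─ (true  ∷ β) (false ∷ I) zero    = refl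
  lookup-─ (false ∷ β) (true  ∷ I) zero    = refl
  lookup-─ (false ∷ β) (false ∷ I) zero    = refl
  lookup-─ (b ∷ β)     (c ∷ I)     (suc i) = lookup-─ β I i

  separated⁺ : ∀ b e x y → T (separated b e x y) → T b → IsEdge e → x ≢ y
  separated⁺ true nothing  x y _ _ e = ⊥-elim (e refl)
  separated⁺ true (just s) x y t _ _ with x ≟ y
  ... | yes _   = ⊥-elim t
  ... | no  x≢y = x≢y

  separated⁻ : ∀ b e x y → (T b → IsEdge e → x ≢ y) → T (separated b e x y)
  separated⁻ false e        x y _ = _
  separated⁻ true  nothing  x y _ = _
  separated⁻ true  (just s) x y f with x ≟ y
  ... | yes x≡y = f _ (λ ()) x≡y
  ... | no  _   = _

  module _ {n : ℕ} (H : SignedGraph n) where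

    ProperOn : Subset n → Vec ℤ n → Set
    ProperOn β κ = ∀ i j → T (lookup β i) → T (lookup β j) → IsEdge (edge H i j) → lookup κ i ≢ lookup κ j

    private
      entry : Subset n → Vec ℤ n → Fin n → Fin n → Bool
      entry β κ i j = separated (lookup β i ∧ lookup β j) (edge H i j) (lookup κ i) (lookup κ j)

    properOn⁺ : ∀ β κ → T (properOn H β κ) → ProperOn β κ
    properOn⁺ β κ t i j βi βj e =
      separated⁺ _ _ _ _ (All.lookup (all⁺ (entry β κ i) (allFin n) (All.lookup (all⁺ _ (allFin n) t) (∈-allFin i))) (∈-allFin j))
                 (Equivalence.from T-∧ (βi , βj)) e

    properOn⁻ : ∀ β κ → ProperOn β κ → T (properOn H β κ)
    properOn⁻ β κ p =
      all⁻ (λ i → all (entry β κ i) (allFin n)) {xs = allFin n} (All.tabulate λ {i} _ →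
      all⁻ (entry β κ i) {xs = allFin n} (All.tabulate λ {j} _ →
      separated⁻ _ _ _ _ λ βij → let βi , βj = Equivalence.to T-∧ βij in p i j βi βj))

    independent : Subset n → Bool
    independent I = properOn H I (replicate n 0ℤ)

    properOn-split : ∀ β I x κ → (∀ i → T (lookup I i) → T (lookup β i)) →
      (∀ i → T (lookup I i) → lookup κ i ≡ x) → (∀ i → T (lookup β i) → ¬ T (lookup I i) → lookup κ i ≢ x) →
      properOn H β κ ≡ independent I ∧ properOn H (β ─ I) κ
    properOn-split β I x κ I⊆β κ≡x κ≢x = T-ext to from
      where
      β─I⁻ : ∀ i → T (lookup (β ─ I) i) → T (lookup β i) × ¬ T (lookup I i)
      β─I⁻ i t with lookup β i | lookup I i | subst T (lookup-─ β I i) t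
      ... | true | false | _ = _ , λ ()
      β─I⁺ : ∀ i → T (lookup β i) → ¬ T (lookup I i) → T (lookup (β ─ I) i)
      β─I⁺ i βi ¬Ii = subst T (sym (lookup-─ β I i)) (Equivalence.from T-∧ (βi , ¬T⇒T-not ¬Ii))
        where
        ¬T⇒T-not : ∀ {b} → ¬ T b → T (not b)
        ¬T⇒T-not {true}  ¬b = ¬b _
        ¬T⇒T-not {false} _  = _
      to : T (properOn H β κ) → T (independent I ∧ properOn H (β ─ I) κ)
      to t = Equivalence.from T-∧ (properOn⁻ I (replicate n 0ℤ) independence , properOn⁻ (β ─ I) κ rest)
        where
        p : ProperOn β κ
        p = properOn⁺ β κ t
        independence : ProperOn I (replicate n 0ℤ)
        independence i j Ii Ij e _ = p i j (I⊆β i Ii) (I⊆β j Ij) e (trans (κ≡x i Ii) (sym (κ≡x j Ij)))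
        rest : ProperOn (β ─ I) κ
        rest i j t₁ t₂ = p i j (proj₁ (β─I⁻ i t₁)) (proj₁ (β─I⁻ j t₂))
      from : T (independent I ∧ properOn H (β ─ I) κ) → T (properOn H β κ)
      from t = properOn⁻ β κ separate
        where
        independence = properOn⁺ I (replicate n 0ℤ) (proj₁ (Equivalence.to (T-∧ {independent I}) t))
        rest = properOn⁺ (β ─ I) κ (proj₂ (Equivalence.to (T-∧ {independent I}) t))
        separate : ProperOn β κ
        separate i j βi βj e κi≡κj with lookup I i in Ii | lookup I j in Ij
        ... | true  | true  = independence i j (Equivalence.from T-≡ Ii) (Equivalence.from T-≡ Ij) e
                                (trans (lookup-replicate i 0ℤ) (sym (lookup-replicate j 0ℤ)))
        ... | true  | false = κ≢x j βj (λ Ij′ → subst T Ij Ij′) (trans (sym κi≡κj) (κ≡x i (Equivalence.from T-≡ Ii)))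
        ... | false | true  = κ≢x i βi (λ Ii′ → subst T Ii Ii′) (trans κi≡κj (κ≡x j (Equivalence.from T-≡ Ij)))
        ... | false | false =
          rest i j (β─I⁺ i βi (λ Ii′ → subst T Ii Ii′)) (β─I⁺ j βj (λ Ij′ → subst T Ij Ij′)) e κi≡κj

    count-factor : ∀ β I x R δ → (∀ i → T (lookup I i) → T (lookup β i)) → (∀ i → T (lookup β i) → x ∉ R i) →
      count n (withColour I x (restrict β R δ)) (properOn H β) ≡
      indicator (independent I) * count n (restrict (β ─ I) R (λ i → if lookup I i then x else δ i)) (properOn H (β ─ I))
    count-factor β I x R δ I⊆β fresh =
      trans (count-cong n L (λ κ κ∈ → properOn-split β I x κ I⊆β (on-I κ κ∈) (off-I κ κ∈)))
      (trans (count-∧ˡ n L (independent I) (properOn H (β ─ I)))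
             (cong (indicator (independent I) *_) (count-lists-cong n (properOn H (β ─ I)) lists)))
      where
      L : Fin n → List ℤ
      L = withColour I x (restrict β R δ)
      lists : ∀ i → L i ≡ restrict (β ─ I) R (λ i → if lookup I i then x else δ i) i
      lists i rewrite lookup-─ β I i with lookup I i | lookup β i
      ... | true  | true  = refl
      ... | true  | false = refl
      ... | false | true  = refl
      ... | false | false = refl
      on-I : ∀ κ → Admissible L κ → ∀ i → T (lookup I i) → lookup κ i ≡ x
      on-I κ κ∈ i Ii with lookup I i | κ∈ i
      ... | true | here κi≡x = κi≡x
      off-I : ∀ κ → Admissible L κ → ∀ i → T (lookup β i) → ¬ T (lookup I i) → lookup κ i ≢ x
      off-I κ κ∈ i βi ¬Ii κi≡x with lookup I i | κ∈ i
      ... | true  | _   = ¬Ii _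
      ... | false | κi∈ with lookup β i | κi∈ | fresh i
      ...   | true | κi∈R | x∉R = x∉R _ (subst (_∈ R i) κi≡x κi∈R)

    count-dummy : ∀ β R δ δ′ → count n (restrict β R δ) (properOn H β) ≡ count n (restrict β R δ′) (properOn H β)
    count-dummy β R δ δ′ =
      trans (count-cong n (restrict β R δ) (λ κ _ → sym (invariant κ)))
      (trans (sym (count-map n π (restrict β R δ) (properOn H β)))
             (count-lists-cong n (properOn H β) lists))
      where
      π : Fin n → ℤ → ℤ
      π i c = if lookup β i then c else δ′ i
      lists : ∀ i → map (π i) (restrict β R δ i) ≡ restrict β R δ′ i
      lists i with lookup β i
      ... | true  = List.map-id (R i)
      ... | false = refl
      invariant : ∀ κ → properOn H β (tabulate (λ i → π i (lookup κ i))) ≡ properOn H β κ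
      invariant κ = all-cong (λ i → all-cong (λ j →
        trans (separated-cong {b = lookup β i ∧ lookup β j} {e = edge H i j} refl (lookup∘tabulate κ′ i) (lookup∘tabulate κ′ j))
              (ignore-inactive i j)) (allFin n)) (allFin n)
        where
        κ′ : Fin n → ℤ
        κ′ = λ i → π i (lookup κ i)
        ignore-inactive : ∀ i j → separated (lookup β i ∧ lookup β j) (edge H i j) (π i (lookup κ i)) (π j (lookup κ j))
                                ≡ separated (lookup β i ∧ lookup β j) (edge H i j) (lookup κ i) (lookup κ j)
        ignore-inactive i j with lookup β i | lookup β j
        ... | true  | true  = refl
        ... | true  | false = refl
        ... | false | _     = refl

  ⊆⇒T : ∀ {n} {I β : Subset n} → I ⊆ β → ∀ i → T (lookup I i) → T (lookup β i)
  ⊆⇒T {I = I} {β} I⊆β i Ii = Equivalence.from T-≡ ([]=⇒lookup (I⊆β (lookup⇒[]= i I (Equivalence.to T-≡ Ii))))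

  degreeBelow-∑ : ∀ {A : Set} {N} xs (g : A → ℕ → ℕ) → (∀ I → I ∈ xs → DegreeBelow N (λ a → + g I a)) →
    DegreeBelow N (λ a → + ∑[ I ∈ xs ] g I a)
  degreeBelow-∑ {N = N} []       g _ = degreeBelow-zero N
  degreeBelow-∑          (x ∷ xs) g d =
    degreeBelow-cong (λ a → sym (pos-+ (g x a) _)) (degreeBelow-+ (d x (here refl)) (degreeBelow-∑ xs g (λ I I∈ → d I (there I∈))))

  module Family {n : ℕ} (H : SignedGraph n) (τ : Fin n → Sign) (m : ℕ) where

    palette : ℕ → Fin n → List ℤ
    palette a i = freshColours m a ++ signedCopy (τ i) (unpairedColours m)

    restricted : Subset n → (Fin n → ℤ) → ℕ → ℕ
    restricted β δ a = count n (restrict β (palette a) δ) (properOn H β)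

    -- Split the colourings with palette a + 1 by the set I of vertices taking the new colour.
    restricted-suc : ∀ β δ a → restricted β δ (suc a) ≡
      restricted β δ a + ∑[ I ∈ nonemptySubsets β ] (indicator (independent H I) * restricted (β ─ I) δ a)
    restricted-suc β δ a =
      trans (count-new-colour n β x (palette a) δ (properOn H β))
            (cong₂ _+_ (count-lists-cong n (properOn H β) no-new-colour) (∑-cong (nonemptySubsets β) term))
      where
      x : ℤ
      x = + suc (m ℕ.+ a)
      no-new-colour : ∀ i → withColour ⊥ x (restrict β (palette a) δ) i ≡ restrict β (palette a) δ i
      no-new-colour i = cong (λ b → if b then x ∷ [] else restrict β (palette a) δ i) (lookup-replicate i false)
      term : ∀ I → I ∈ nonemptySubsets β → count n (withColour I x (restrict β (palette a) δ)) (properOn H β) ≡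
                                            indicator (independent H I) * restricted (β ─ I) δ a
      term I I∈ = trans (count-factor H β I x (palette a) δ (⊆⇒T (∈-nonemptySubsets⇒⊆ β I∈)) (λ i _ → fresh-∉ m a (τ i)))
                        (cong (indicator (independent H I) *_) (count-dummy H (β ─ I) (palette a) _ δ))

    Δ-restricted : ∀ β δ a → Δ (λ a → + restricted β δ a) a ≡
      + ∑[ I ∈ nonemptySubsets β ] (indicator (independent H I) * restricted (β ─ I) δ a)
    Δ-restricted β δ a = trans (cong (ℤ._- + restricted β δ a) (trans (cong +_ (restricted-suc β δ a)) (pos-+ (restricted β δ a) _)))
                               (cancel (+ restricted β δ a) _)
      where
      cancel : ∀ r s → r ℤ.+ s ℤ.- r ≡ s
      cancel = ℤ-Solver.solve-∀

    restricted-degree : ∀ k β δ → ∣ β ∣ ≤ k → DegreeBelow (suc k) (λ a → + restricted β δ a)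
    restricted-degree k β δ ∣β∣≤k =
      Δ-below (degreeBelow-cong (λ a → sym (Δ-restricted β δ a)) (degreeBelow-∑ (nonemptySubsets β) _ (term k ∣β∣≤k)))
      where
      shrinks : ∀ {I} → I ∈ nonemptySubsets β → ∣ β ─ I ∣ < ∣ β ∣
      shrinks I∈ = p∩q≢∅⇒∣p─q∣<∣p∣ β _ (∈-nonemptySubsets⇒meets β I∈)
      term : ∀ k → ∣ β ∣ ≤ k → ∀ I → I ∈ nonemptySubsets β →
        DegreeBelow k (λ a → + (indicator (independent H I) * restricted (β ─ I) δ a))
      term zero    ∣β∣≤0 I I∈ = ⊥-elim (ℕ.n≮0 (ℕ.<-≤-trans (shrinks I∈) ∣β∣≤0))
      term (suc k) ∣β∣≤k I I∈ =
        degreeBelow-cong (λ a → sym (pos-* (indicator (independent H I)) (restricted (β ─ I) δ a)))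
          (degreeBelow-*ˡ (+ indicator (independent H I))
            (restricted-degree k (β ─ I) δ (ℕ.≤-pred (ℕ.<-≤-trans (shrinks I∈) ∣β∣≤k))))

  colourings-degree : ∀ {n} (H : SignedGraph n) τ m → DegreeBelow (suc n) (λ a → + colourings H τ m a)
  colourings-degree {n} H τ m =
    degreeBelow-cong (λ a → cong +_ (count-lists-cong n (properOn H ⊤) (everywhere a)))
      (restricted-degree n ⊤ (λ _ → 0ℤ) (∣p∣≤n ⊤))
    where
    open Family H τ m
    everywhere : ∀ a i → restrict ⊤ (palette a) (λ _ → 0ℤ) i ≡ palette a i
    everywhere a i = cong (λ b → if b then palette a i else 0ℤ ∷ []) (lookup-replicate i true)

module DominatingVertex where

  open import Data.Nat using (ℕ; zero; suc)
  open import Data.Integer using (ℤ; _≟_)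
  open import Data.Fin using (Fin; punchIn; punchOut)
  open import Data.Fin.Properties using (punchIn-punchOut; punchInᵢ≢i) renaming (_≟_ to _≟ᶠ_)
  open import Data.Bool using (Bool; _∧_; T)
  open import Data.Bool.Properties using (T-∧)
  open import Data.Bool.ListAction using (all)
  open import Data.Maybe using (just)
  open import Data.Sign using (Sign)
  open import Data.List using (List; allFin)
  open import Data.List.Membership.Propositional.Properties using (∈-allFin)
  open import Data.List.Relation.Unary.All as All using ()
  open import Data.List.Relation.Unary.All.Properties using (all⁺; all⁻)
  open import Data.Vec using (Vec; []; _∷_; lookup; insertAt)
  open import Data.Vec.Properties using (insertAt-lookup; insertAt-punchIn)
  open import Data.Product using (_,_; proj₁; proj₂)
  open import Data.Empty using (⊥-elim)
  open import Function using (_∘_; _⇔_; mk⇔; Equivalence)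
  open import Relation.Binary.PropositionalEquality
  open import Relation.Nullary using (¬?; does; yes; no)
  open import Defs
  open Counting
  open ColourSets using (_∖_)
  open ListColouring using (applySign-involutive)

  T-≢ : ∀ {x d : ℤ} → T (does (¬? (x ≟ d))) ⇔ x ≢ d
  T-≢ {x} {d} with x ≟ d
  ... | yes x≡d = mk⇔ ⊥-elim (λ x≢d → x≢d x≡d)
  ... | no  x≢d = mk⇔ (λ _ → x≢d) (λ _ → _)

  T-edgeOK : ∀ s a b → T (edgeOK (just s) a b) ⇔ a ≢ applySign s b
  T-edgeOK s a b with a ≟ applySign s b
  ... | yes a≡ = mk⇔ ⊥-elim (λ a≢ → a≢ a≡)
  ... | no  a≢ = mk⇔ (λ _ → a≢) (λ _ → _)

  ≢-applySign-swap : ∀ s {a b} → a ≢ applySign s b → b ≢ applySign s a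
  ≢-applySign-swap s {a} {b} a≢ b≡ = a≢ (trans (sym (applySign-involutive s a)) (cong (applySign s) (sym b≡)))

  module _ {n : ℕ} (G : SignedGraph n) where

    private
      entry : Vec ℤ n → Fin n → Fin n → Bool
      entry κ i j = edgeOK (edge G i j) (lookup κ i) (lookup κ j)

    isProper⁺ : ∀ κ → T (isProper G κ) → ∀ i j → T (entry κ i j)
    isProper⁺ κ t i j = All.lookup (all⁺ (entry κ i) (allFin n) (All.lookup (all⁺ _ (allFin n) t) (∈-allFin i))) (∈-allFin j)

    isProper⁻ : ∀ κ → (∀ i j → T (entry κ i j)) → T (isProper G κ)
    isProper⁻ κ ok = all⁻ (λ i → all (entry κ i) (allFin n)) {xs = allFin n}
      (All.tabulate λ {i} _ → all⁻ (entry κ i) {xs = allFin n} (All.tabulate λ {j} _ → ok i j))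

  allᵛ⁺ : ∀ {n} D (κ : Vec ℤ n) → T (allᵛ D κ) → ∀ i → T (D (lookup κ i))
  allᵛ⁺ D (x ∷ κ) t Fin.zero    = proj₁ (Equivalence.to T-∧ t)
  allᵛ⁺ D (x ∷ κ) t (Fin.suc i) = allᵛ⁺ D κ (proj₂ (Equivalence.to (T-∧ {D x}) t)) i

  allᵛ⁻ : ∀ {n} D (κ : Vec ℤ n) → (∀ i → T (D (lookup κ i))) → T (allᵛ D κ)
  allᵛ⁻ D []      _  = _
  allᵛ⁻ D (x ∷ κ) ok = Equivalence.from T-∧ (ok Fin.zero , allᵛ⁻ D κ (ok ∘ Fin.suc))

  data PunchView {n} (v : Fin (suc n)) : Fin (suc n) → Set where
    at      : PunchView v v
    punched : ∀ j → PunchView v (punchIn v j)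

  punchView : ∀ {n} (v i : Fin (suc n)) → PunchView v i
  punchView v i with v ≟ᶠ i
  ... | yes refl = at
  ... | no  v≢i  = subst (PunchView v) (punchIn-punchOut v≢i) (punched (punchOut v≢i))

  avoids : Sign → ℤ → ℤ → Bool
  avoids s c x = does (¬? (x ≟ applySign s c))

  isProper-insertAt : ∀ {n} (G : SignedGraph (suc n)) v s → DominatingOfSign G v s → ∀ κ c →
    isProper G (insertAt κ v c) ≡ isProper (deleteVertex G v) κ ∧ allᵛ (avoids s c) κ
  isProper-insertAt {n} G v s dominating κ c = T-ext to from
    where
    H : SignedGraph n
    H = deleteVertex G v
    κ′ : Vec ℤ (suc n)
    κ′ = insertAt κ v c
    at-v : lookup κ′ v ≡ c
    at-v = insertAt-lookup κ v c
    at-punchIn : ∀ j → lookup κ′ (punchIn v j) ≡ lookup κ j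
    at-punchIn j = insertAt-punchIn κ v c j
    from-v : ∀ j → edge G v (punchIn v j) ≡ just s
    from-v j = dominating (punchIn v j) (punchInᵢ≢i v j)
    to-v : ∀ j → edge G (punchIn v j) v ≡ just s
    to-v j = trans (symm G _ _) (from-v j)
    to : T (isProper G κ′) → T (isProper H κ ∧ allᵛ (avoids s c) κ)
    to t = Equivalence.from T-∧ (isProper⁻ H κ proper-H , allᵛ⁻ (avoids s c) κ avoid)
      where
      ok : ∀ i j → T (edgeOK (edge G i j) (lookup κ′ i) (lookup κ′ j))
      ok = isProper⁺ G κ′ t
      proper-H : ∀ i j → T (edgeOK (edge H i j) (lookup κ i) (lookup κ j))
      proper-H i j = subst₂ (λ a b → T (edgeOK (edge H i j) a b)) (at-punchIn i) (at-punchIn j) (ok (punchIn v i) (punchIn v j))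
      avoid : ∀ j → T (avoids s c (lookup κ j))
      avoid j with ok v (punchIn v j)
      ... | ok-vj rewrite from-v j | at-v | at-punchIn j =
        Equivalence.from T-≢ (≢-applySign-swap s (Equivalence.to (T-edgeOK s c (lookup κ j)) ok-vj))
    from : T (isProper H κ ∧ allᵛ (avoids s c) κ) → T (isProper G κ′)
    from t = isProper⁻ G κ′ ok
      where
      ok-H : ∀ i j → T (edgeOK (edge H i j) (lookup κ i) (lookup κ j))
      ok-H = isProper⁺ H κ (proj₁ (Equivalence.to T-∧ t))
      avoid : ∀ j → c ≢ applySign s (lookup κ j)
      avoid j = ≢-applySign-swap s (Equivalence.to T-≢ (allᵛ⁺ (avoids s c) κ (proj₂ (Equivalence.to (T-∧ {isProper H κ}) t)) j))
      ok : ∀ i j → T (edgeOK (edge G i j) (lookup κ′ i) (lookup κ′ j))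
      ok i j with punchView v i | punchView v j
      ... | at        | at        rewrite noLoop G v = _
      ... | at        | punched j′ rewrite from-v j′ | at-v | at-punchIn j′ = Equivalence.from (T-edgeOK s c _) (avoid j′)
      ... | punched i′ | at        rewrite to-v i′ | at-v | at-punchIn i′ =
        Equivalence.from (T-edgeOK s _ c) (≢-applySign-swap s (avoid i′))
      ... | punched i′ | punched j′ rewrite at-punchIn i′ | at-punchIn j′ = ok-H i′ j′

  numProperColourings-dominating : ∀ {n} (G : SignedGraph (suc n)) v s → DominatingOfSign G v s → ∀ C →
    numProperColourings G C ≡ ∑[ c ∈ C ] count n (λ _ → C ∖ applySign s c) (isProper (deleteVertex G v))
  numProperColourings-dominating {n} G v s dominating C =
    trans (numProperColourings≡count G C)
    (trans (count-insertAt n v (λ _ → C) (isProper G))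
    (∑-cong C λ c _ →
      trans (count-cong n (λ _ → C) (λ κ _ → isProper-insertAt G v s dominating κ c))
            (count-allᵛ n (λ _ → C) (isProper (deleteVertex G v)) (λ x → ¬? (x ≟ applySign s c)))))

open import Defs
open import Data.Nat as ℕ using (ℕ; suc; _∸_; _%_; _≤_)
import Data.Nat.Properties as ℕ
open import Data.Integer using (ℤ; +_; 0ℤ; 1ℤ; -1ℤ; _+_; _-_; _*_; -_)
open import Data.Integer.Properties using (pos-+; *-zeroˡ; neg-involutive; +-identityʳ)
open import Data.Integer.Tactic.RingSolver using (solve-∀)
open import Data.Fin using (Fin)
open import Data.Sign as Sign using (Sign)
open import Data.List using (List; []; _∷_; _++_; length)
import Data.List.Properties as List
open import Data.List.Membership.Propositional using (_∈_; _∉_)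
open import Data.List.Relation.Unary.Any using (here; there)
open import Data.Product using (∃; _,_; proj₁; proj₂)
open import Data.Sum using (_⊎_; inj₁; inj₂)
open import Function using (_∘_)
open import Relation.Binary.PropositionalEquality
open ≡-Reasoning
open FiniteDifferences
open Counting
open ColourSets
open Switching
open ListColouring
open Polynomiality
open DominatingVertex

∑-constant : ∀ {A : Set} (xs : List A) (φ : A → ℕ) w → (∀ c → c ∈ xs → + φ c ≡ w) → + ∑ xs φ ≡ + length xs * w
∑-constant []       φ w _     = sym (*-zeroˡ w)
∑-constant (c ∷ xs) φ w φ≡w = begin
  + (φ c ℕ.+ ∑ xs φ)        ≡⟨ pos-+ (φ c) (∑ xs φ) ⟩
  + φ c + + ∑ xs φ          ≡⟨ cong₂ _+_ (φ≡w c (here refl)) (∑-constant xs φ w (λ c′ → φ≡w c′ ∘ there)) ⟩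
  w + + length xs * w       ≡⟨ ring (+ length xs) w ⟩
  (+ 1 + + length xs) * w   ∎
  where
  ring : ∀ k w → w + k * w ≡ (+ 1 + k) * w
  ring = solve-∀

unpairedValue : Sign → (ℤ → ℤ → ℤ) → ℤ → ℤ → ℤ
unpairedValue Sign.+ E x y = E (x - 1ℤ) (y - 1ℤ)
unpairedValue Sign.- E x y = E x y

module Deletion {n : ℕ} (G : SignedGraph (suc n)) (v : Fin (suc n)) (s : Sign) (dominating : DominatingOfSign G v s)
                (τ : Fin n → Sign) (switching : IsSwitching (deleteVertex G v) τ)
                (pE′ : Poly2) (isE′ : IsEPoly (deleteVertex G v) pE′) where

  H : SignedGraph n
  H = deleteVertex G v
  E′ : ℤ → ℤ → ℤ
  E′ = eval2 pE′

  colourings-even : ∀ m k → + colourings H τ m (k ℕ.+ k) ≡ E′ (+ (m ℕ.+ (k ℕ.+ k))) (+ m)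
  colourings-even m k with colourSet-even m k
  ... | C , C-colourSet with decomposition C-colourSet
  ...   | d , shared≡ , unpaired≡ , _ = begin
    + colourings H τ m (k ℕ.+ k)       ≡⟨ cong +_ (cong₂ (colourings H τ) unpaired≡ (trans shared≡ m+2k∸m)) ⟨
    + colourings H τ unpaired shared   ≡⟨ cong +_ (count≡colourings H τ switching d) ⟨
    + count n (λ _ → C) (isProper H)  ≡⟨ cong +_ (numProperColourings≡count H C) ⟨
    + numProperColourings H C          ≡⟨ isE′ (m ℕ.+ (k ℕ.+ k)) m (ℕ.m≤m+n m _) parity C C-colourSet ⟨
    E′ (+ (m ℕ.+ (k ℕ.+ k))) (+ m)     ∎
    where
    open Decomposition d
    m+2k∸m : m ℕ.+ (k ℕ.+ k) ∸ m ≡ k ℕ.+ k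
    m+2k∸m = ℕ.m+n∸m≡n m (k ℕ.+ k)
    parity : (m ℕ.+ (k ℕ.+ k) ∸ m) % 2 ≡ 0
    parity = subst (λ a → a % 2 ≡ 0) (sym m+2k∸m) (even-%2 k)

  -- The hypothesis on pE′ only covers even a; polynomiality in a extends it to all a.
  colourings≡E′ : ∀ m a → + colourings H τ m a ≡ E′ (+ (m ℕ.+ a)) (+ m)
  colourings≡E′ m = agreeing-on-evens⇒equal (colourings-degree H τ m) E′-degree (colourings-even m)
    where
    E′-degree : DegreeBelow (proj₁ (polynomial²-eval2 pE′)) (λ a → E′ (+ (m ℕ.+ a)) (+ m))
    E′-degree = DegreeBelowᶻ.at (DegreeBelow².in-x (proj₂ (polynomial²-eval2 pE′)) (+ m)) (+ m)

  count≡E′ : ∀ {C} (d : Decomposition C) → let open Decomposition d in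
    + count n (λ _ → C) (isProper H) ≡ E′ (+ (unpaired ℕ.+ shared)) (+ unpaired)
  count≡E′ d = trans (cong +_ (count≡colourings H τ switching d)) (colourings≡E′ _ _)

  A B V : ℤ → ℤ → ℤ
  A x y = E′ (x - 1ℤ) (y + 1ℤ)
  B x y = E′ (x - 1ℤ) y
  V = unpairedValue s E′

  module _ {C : List ℤ} (d : Decomposition C) where
    open Decomposition d

    X Y : ℤ
    X = + (unpaired ℕ.+ shared)
    Y = + unpaired

    avoiding : ℤ → ℕ
    avoiding c = count n (λ _ → C ∖ applySign s c) (isProper H)

    zero-class : ∀ {c} → c ∈ Z → + avoiding c ≡ B X Y
    zero-class c∈Z with Z-zero c∈Z
    ... | refl with remove-zero d c∈Z
    ...   | d′ , shared≡ , unpaired≡ = begin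
      + avoiding 0ℤ                         ≡⟨ cong (λ c → + count n (λ _ → C ∖ c) (isProper H)) (applySign-0 s) ⟩
      + count n (λ _ → C ∖ 0ℤ) (isProper H) ≡⟨ count≡E′ d′ ⟩
      E′ (+ (unpaired′ ℕ.+ shared′)) (+ unpaired′) ≡⟨ cong₂ E′ x≡ (cong +_ unpaired≡) ⟩
      B X Y                                 ∎
      where
      open Decomposition d′ renaming (shared to shared′; unpaired to unpaired′) using ()
      applySign-0 : ∀ s → applySign s 0ℤ ≡ 0ℤ
      applySign-0 Sign.+ = refl
      applySign-0 Sign.- = refl
      -- Here and below, + suc k - 1ℤ reduces to + k.
      x≡ : + (unpaired′ ℕ.+ shared′) ≡ X - 1ℤ
      x≡ = begin
        + (unpaired′ ℕ.+ shared′)        ≡⟨ cong (λ m → + (m ℕ.+ shared′)) unpaired≡ ⟩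
        + (unpaired ℕ.+ shared′)         ≡⟨ cong (λ k → + k - 1ℤ) (ℕ.+-suc unpaired shared′) ⟨
        + (unpaired ℕ.+ suc shared′) - 1ℤ ≡⟨ cong (λ a → + (unpaired ℕ.+ a) - 1ℤ) shared≡ ⟩
        X - 1ℤ                           ∎

    pair-class : ∀ {c} → c ∈ P → + avoiding c ≡ A X Y
    pair-class {c} c∈P with remove-pair d (signed-P s)
      where
      signed-P : ∀ t → applySign t c ∈ P
      signed-P Sign.+ = c∈P
      signed-P Sign.- = P-symmetric c∈P
    ... | d′ , shared≡ , unpaired≡ = trans (count≡E′ d′) (cong₂ E′ x≡ y≡)
      where
      open Decomposition d′ renaming (shared to shared′; unpaired to unpaired′) using ()
      x≡ : + (unpaired′ ℕ.+ shared′) ≡ X - 1ℤ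
      x≡ = begin
        + (unpaired′ ℕ.+ shared′)                ≡⟨ cong (λ m → + (m ℕ.+ shared′)) unpaired≡ ⟩
        + suc (unpaired ℕ.+ shared′)             ≡⟨ cong +_ (ℕ.+-suc unpaired shared′) ⟨
        + (unpaired ℕ.+ suc shared′)             ≡⟨ cong (λ k → + k - 1ℤ) (ℕ.+-suc unpaired (suc shared′)) ⟨
        + (unpaired ℕ.+ (2 ℕ.+ shared′)) - 1ℤ    ≡⟨ cong (λ a → + (unpaired ℕ.+ a) - 1ℤ) shared≡ ⟩
        X - 1ℤ                                   ∎
      y≡ : + unpaired′ ≡ Y + 1ℤ
      y≡ = cong +_ (trans unpaired≡ (ℕ.+-comm 1 unpaired))

    unpaired-class : ∀ {c} → c ∈ U → + avoiding c ≡ V X Y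
    unpaired-class {c} c∈U = by-sign s refl
      where
      -c∉C : - c ∉ C
      -c∉C -c∈C with C-cases -c∈C
      ... | inj₁ -c∈Z        = U-nonzero c∈U (neg-swap (Z-zero -c∈Z))
      ... | inj₂ (inj₁ -c∈P) = P-disjoint-U (subst (_∈ P) (neg-involutive c) (P-symmetric -c∈P)) c∈U
      ... | inj₂ (inj₂ -c∈U) = U-antisymmetric c∈U -c∈U
      by-sign : ∀ t → s ≡ t → + avoiding c ≡ unpairedValue t E′ X Y
      by-sign Sign.+ refl with remove-unpaired d c∈U
      ... | d′ , shared≡ , unpaired≡ =
        trans (count≡E′ d′)
              (cong₂ E′ (cong₂ (λ m a → + (m ℕ.+ a) - 1ℤ) unpaired≡ shared≡) (cong (λ m → + m - 1ℤ) unpaired≡))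
      by-sign Sign.- refl = trans (cong (λ C′ → + count n (λ _ → C′) (isProper H)) (∖-∉ C -c∉C)) (count≡E′ d)

    numProperColourings-classes : + numProperColourings G C ≡ + length Z * B X Y + (+ length P * A X Y + + length U * V X Y)
    numProperColourings-classes = begin
      + numProperColourings G C                      ≡⟨ cong +_ (numProperColourings-dominating G v s dominating C) ⟩
      + ∑ C avoiding                                 ≡⟨ cong +_ (∑-↭ avoiding C↭Z++P++U) ⟩
      + ∑ (Z ++ P ++ U) avoiding
        ≡⟨ cong +_ (trans (∑-++ Z (P ++ U) avoiding) (cong (∑ Z avoiding ℕ.+_) (∑-++ P U avoiding))) ⟩
      + (∑ Z avoiding ℕ.+ (∑ P avoiding ℕ.+ ∑ U avoiding))
        ≡⟨ trans (pos-+ (∑ Z avoiding) _) (cong (λ w → + ∑ Z avoiding + w) (pos-+ (∑ P avoiding) _)) ⟩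
      + ∑ Z avoiding + (+ ∑ P avoiding + + ∑ U avoiding)
        ≡⟨ cong₂ _+_ (∑-constant Z avoiding (B X Y) (λ _ → zero-class))
                     (cong₂ _+_ (∑-constant P avoiding (A X Y) (λ _ → pair-class))
                                (∑-constant U avoiding (V X Y) (λ _ → unpaired-class))) ⟩
      + length Z * B X Y + (+ length P * A X Y + + length U * V X Y) ∎

  predicted : ℤ → ℤ → ℕ → ℤ
  predicted x y z = + z * B x y + ((x - y - + z) * A x y + y * V x y)

  numProperColourings-predicted : ∀ {l m C} → m ≤ l → IsColourSet l m C →
    + numProperColourings G C ≡ predicted (+ l) (+ m) ((l ∸ m) % 2)
  numProperColourings-predicted {l} {m} {C} m≤l C-colourSet with decomposition C-colourSet
  ... | d , shared≡ , unpaired≡ , |Z|≡ = begin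
    + numProperColourings G C                                      ≡⟨ numProperColourings-classes d ⟩
    + length Z * B (X d) (Y d) + (+ length P * A (X d) (Y d) + Y d * V (X d) (Y d))
      ≡⟨ cong (λ p → + length Z * B (X d) (Y d) + (p * A (X d) (Y d) + Y d * V (X d) (Y d))) |P|≡ ⟩
    predicted (X d) (Y d) (length Z)                               ≡⟨ cong₂ (λ x y → predicted x y (length Z)) X≡ Y≡ ⟩
    predicted (+ l) (+ m) (length Z)                               ≡⟨ cong (predicted (+ l) (+ m)) |Z|≡ ⟩
    predicted (+ l) (+ m) ((l ∸ m) % 2)                            ∎
    where
    open Decomposition d
    X≡ : X d ≡ + l
    X≡ = cong +_ (trans (cong₂ ℕ._+_ unpaired≡ shared≡) (ℕ.m+[n∸m]≡n m≤l))
    Y≡ : Y d ≡ + m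
    Y≡ = cong +_ unpaired≡
    |P|≡ : + length P ≡ X d - Y d - + length Z
    |P|≡ = begin
      + length P                                                        ≡⟨ ring (+ length U) (+ length Z) (+ length P) ⟩
      + length U + (+ length Z + + length P) - + length U - + length Z  ≡⟨ cong (λ w → w - + length U - + length Z) X-split ⟨
      X d - Y d - + length Z                                            ∎
      where
      ring : ∀ u z p → p ≡ u + (z + p) - u - z
      ring = solve-∀
      X-split : X d ≡ + length U + (+ length Z + + length P)
      X-split = trans (cong (λ a → + (length U ℕ.+ a)) (List.length-++ Z))
                      (trans (pos-+ (length U) _) (cong (λ w → + length U + w) (pos-+ (length Z) (length P))))

  polynomial-A : Polynomial² A
  polynomial-A = polynomial²-shift -1ℤ 1ℤ (polynomial²-eval2 pE′)

  polynomial-B : Polynomial² B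
  polynomial-B = polynomial²-cong (λ x y → cong (E′ (x - 1ℤ)) (+-identityʳ y)) (polynomial²-shift -1ℤ 0ℤ (polynomial²-eval2 pE′))

  polynomial-V : Polynomial² V
  polynomial-V = by-sign s
    where
    by-sign : ∀ t → Polynomial² (unpairedValue t E′)
    by-sign Sign.+ = polynomial²-shift -1ℤ -1ℤ (polynomial²-eval2 pE′)
    by-sign Sign.- = polynomial²-eval2 pE′

  polynomial-[x-y]A : Polynomial² (λ x y → (x - y) * A x y)
  polynomial-[x-y]A = polynomial²-cong (λ x y → ring x y (A x y))
    (polynomial²-difference (polynomial²-x* polynomial-A) (polynomial²-y* polynomial-A))
    where
    ring : ∀ x y a → x * a - y * a ≡ (x - y) * a
    ring = solve-∀

  E-formula : ∀ pE → IsEPoly G pE → ∀ x y → eval2 pE x y ≡ (x - y) * A x y + y * V x y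
  E-formula pE isE =
    agreeing-on-lattice²⇒equal (polynomial²-eval2 pE) (polynomial²-+ polynomial-[x-y]A (polynomial²-y* polynomial-V)) 0 at-lattice
    where
    at-lattice : ∀ m k → let l = m ℕ.+ (k ℕ.+ k) in eval2 pE (+ l) (+ m) ≡ (+ l - + m) * A (+ l) (+ m) + + m * V (+ l) (+ m)
    at-lattice m k with colourSet-even m k
    ... | C , C-colourSet = begin
      eval2 pE (+ l) (+ m)                  ≡⟨ isE l m m≤l parity C C-colourSet ⟩
      + numProperColourings G C             ≡⟨ numProperColourings-predicted m≤l C-colourSet ⟩
      predicted (+ l) (+ m) ((l ∸ m) % 2)   ≡⟨ cong (predicted (+ l) (+ m)) parity ⟩
      predicted (+ l) (+ m) 0               ≡⟨ ring (+ l) (+ m) (B (+ l) (+ m)) (A (+ l) (+ m)) (V (+ l) (+ m)) ⟩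
      (+ l - + m) * A (+ l) (+ m) + + m * V (+ l) (+ m) ∎
      where
      l : ℕ
      l = m ℕ.+ (k ℕ.+ k)
      m≤l : m ≤ l
      m≤l = ℕ.m≤m+n m (k ℕ.+ k)
      parity : (l ∸ m) % 2 ≡ 0
      parity = subst (λ a → a % 2 ≡ 0) (sym (ℕ.m+n∸m≡n m (k ℕ.+ k))) (even-%2 k)
      ring : ∀ x y b a w → + 0 * b + ((x - y - + 0) * a + y * w) ≡ (x - y) * a + y * w
      ring = solve-∀

  O-formula : ∀ pO → IsOPoly G pO → ∀ x y → eval2 pO x y ≡ B x y + ((x - y - 1ℤ) * A x y + y * V x y)
  O-formula pO isO = agreeing-on-lattice²⇒equal (polynomial²-eval2 pO) polynomial-RHS 1 at-lattice
    where
    polynomial-RHS : Polynomial² (λ x y → B x y + ((x - y - 1ℤ) * A x y + y * V x y))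
    polynomial-RHS = polynomial²-+ polynomial-B (polynomial²-cong (λ x y → cong (_+ y * V x y) (ring x y (A x y)))
      (polynomial²-+ (polynomial²-difference polynomial-[x-y]A polynomial-A) (polynomial²-y* polynomial-V)))
      where
      ring : ∀ x y a → (x - y) * a - a ≡ (x - y - 1ℤ) * a
      ring = solve-∀
    at-lattice : ∀ m k → let l = m ℕ.+ suc (k ℕ.+ k) in
      eval2 pO (+ l) (+ m) ≡ B (+ l) (+ m) + ((+ l - + m - 1ℤ) * A (+ l) (+ m) + + m * V (+ l) (+ m))
    at-lattice m k with colourSet-odd m k
    ... | C , C-colourSet = begin
      eval2 pO (+ l) (+ m)                  ≡⟨ isO l m m≤l parity C C-colourSet ⟩
      + numProperColourings G C             ≡⟨ numProperColourings-predicted m≤l C-colourSet ⟩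
      predicted (+ l) (+ m) ((l ∸ m) % 2)   ≡⟨ cong (predicted (+ l) (+ m)) parity ⟩
      predicted (+ l) (+ m) 1               ≡⟨ ring (+ l) (+ m) (B (+ l) (+ m)) (A (+ l) (+ m)) (V (+ l) (+ m)) ⟩
      B (+ l) (+ m) + ((+ l - + m - 1ℤ) * A (+ l) (+ m) + + m * V (+ l) (+ m)) ∎
      where
      l : ℕ
      l = m ℕ.+ suc (k ℕ.+ k)
      m≤l : m ≤ l
      m≤l = ℕ.m≤m+n m (suc (k ℕ.+ k))
      parity : (l ∸ m) % 2 ≡ 1
      parity = subst (λ a → a % 2 ≡ 1) (sym (ℕ.m+n∸m≡n m (suc (k ℕ.+ k)))) (odd-%2 k)
      ring : ∀ x y b a w → + 1 * b + ((x - y - + 1) * a + y * w) ≡ b + ((x - y - 1ℤ) * a + y * w)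
      ring = solve-∀

  E-O-formula : ∀ pE pO → IsEPoly G pE → IsOPoly G pO → ∀ x y → eval2 pE x y - eval2 pO x y ≡ A x y - B x y
  E-O-formula pE pO isE isO x y = begin
    eval2 pE x y - eval2 pO x y                                                  ≡⟨ cong₂ _-_ (E-formula pE isE x y) (O-formula pO isO x y) ⟩
    ((x - y) * A x y + y * V x y) - (B x y + ((x - y - 1ℤ) * A x y + y * V x y)) ≡⟨ ring x y (A x y) (B x y) (V x y) ⟩
    A x y - B x y                                                                ∎
    where
    ring : ∀ x y a b w → ((x - y) * a + y * w) - (b + ((x - y - 1ℤ) * a + y * w)) ≡ a - b
    ring = solve-∀

dominatingSign : ∀ {n} {G : SignedGraph n} {v} → PositiveDominating G v ⊎ NegativeDominating G v → ∃ (DominatingOfSign G v)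
dominatingSign (inj₁ positive) = Sign.+ , positive
dominatingSign (inj₂ negative) = Sign.- , negative

corollary4p11 : ∀ {n : ℕ} (G : SignedGraph (suc n)) (v : Fin (suc n)) →
    (PositiveDominating G v ⊎ NegativeDominating G v) →
    Balanced (deleteVertex G v) →
    ∀ (pE pO pE' : Poly2) →
    IsEPoly G pE → IsOPoly G pO → IsEPoly (deleteVertex G v) pE' →
    ∀ (x y : ℤ) →
    eval2 pE x y - eval2 pO x y ≡ eval2 pE' (x - 1ℤ) (y + 1ℤ) - eval2 pE' (x - 1ℤ) y
corollary4p11 G v dominating balanced pE pO pE′ isE isO isE′
  with dominatingSign {G = G} dominating | balanced⇒switching (deleteVertex G v) balanced
... | s , s-dominating | τ , switching = E-O-formula pE pO isE isO
  where open Deletion G v s s-dominating τ switching pE′ isE′
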